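{- Let $G=(V,E)$ be a finite directed graph with kernel $K$ and nowhere-zero stationary distribution $\pi$. Then: (a) for all $1\le n\le|V|$, $0\le\tilde\iota_n(G)-\iota_n(G)\le\frac1n$; (b) $\tilde\iota_2(G)=\iota_2(G)$ (when $|V|\ge2$); (c) for all $1\le n\le|V|-1$, $\tilde\iota_n(G)\le\big(1-\frac1{n^2}\big)\tilde\iota_{n+1}(G)$; (d) for all $1\le n\le|V|-1$, $\iota_n(G)\le\iota_{n+1}(G)$.
   Context: $G=(V,E)$ is a finite directed graph (loops allowed); $K$ is a row-stochastic matrix on $V$ with $K(u,v)>0$ for $uv\in E$ and $K(u,v)=0$ for $u\ne v$, $uv\notin E$; $\pi:V\to(0,\infty)$ is a probability vector with $\pi K=\pi$. $\phi(u,v)=K(u,v)\pi(u)$; $\pi(Q)=\sum_{u\in Q}\pi(u)$; $\vec\partial(Q)=\sum_{u\in Q,v\notin Q}\phi(u,v)$. $\iota_n(G)=\min\frac1n\sum_{i=1}^n\vec\partial(Q_i)/\pi(Q_i)$ over all families of $n$ nonempty pairwise disjoint subsets $Q_1,\dots,Q_n$ of $V$; $\tilde\iota_n(G)$ is the same minimum taken only over partitions of $V$ into $n$ nonempty blocks. -}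

module Defs where

open import Level using (0ℓ)
open import Data.Nat as ℕ using (ℕ; zero; suc)
open import Data.Fin using (Fin; zero; suc; _≟_)
open import Data.Fin.Properties using (all?; any?)
open import Data.List using (List; []; _∷_; [_]; map; concatMap; allFin; filter)
open import Data.Product using (Σ; ∃; _×_; _,_)
open import Relation.Nullary using (¬_; Dec; yes; no; does)
open import Relation.Binary using (Rel; IsDecTotalOrder)
open import Relation.Binary.PropositionalEquality using (_≡_)
open import Algebra.Bundles using (CommutativeRing)
open import Data.Bool using (if_then_else_)

-- Ordered fields (the scalars).  The paper works over ℝ; agda-stdlib has
-- no reals, so we quantify over every ordered field.

record OrderedField : Set₁ where
  field
    commutativeRing : CommutativeRing 0ℓ 0ℓ
  open CommutativeRing commutativeRing public hiding (zero)
  infix 4 _≤_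
  field
    _≤_            : Rel Carrier 0ℓ
    isDecTotalOrder : IsDecTotalOrder _≈_ _≤_
    +-monoˡ-≤      : ∀ {x y} z → x ≤ y → x + z ≤ y + z
    *-nonneg       : ∀ {x y} → 0# ≤ x → 0# ≤ y → 0# ≤ x * y
    0≉1            : ¬ (0# ≈ 1#)
    _⁻¹            : Carrier → Carrier
    ⁻¹-inverseʳ    : ∀ x → ¬ (x ≈ 0#) → x * (x ⁻¹) ≈ 1#

  open IsDecTotalOrder isDecTotalOrder public using (_≤?_)

  _<_ : Rel Carrier 0ℓ
  x < y = x ≤ y × ¬ (x ≈ y)

  min : Carrier → Carrier → Carrier
  min x y = if does (x ≤? y) then x else y

  -- minimum of a list (default value for the empty list; never used
  -- in the statement since the lists there are nonempty)
  minimumL : List Carrier → Carrier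
  minimumL []       = 0#
  minimumL (x ∷ []) = x
  minimumL (x ∷ xs@(_ ∷ _)) = min x (minimumL xs)

  fromℕ : ℕ → Carrier
  fromℕ zero    = 0#
  fromℕ (suc n) = 1# + fromℕ n

  sumF : ∀ {N} → (Fin N → Carrier) → Carrier
  sumF {zero}  f = 0#
  sumF {suc N} f = f zero + sumF (λ i → f (suc i))

record MarkovGraph (F : OrderedField) (N : ℕ) : Set₁ where
  open OrderedField F
  field
    E        : Fin N → Fin N → Set          -- edge relation (loops allowed)
    K        : Fin N → Fin N → Carrier
    π        : Fin N → Carrier
    K-nonneg : ∀ u v → 0# ≤ K u v
    K-rows   : ∀ u → sumF (λ v → K u v) ≈ 1#
    K-edge   : ∀ u v → E u v → 0# < K u v
    K-nonedge : ∀ u v → ¬ (u ≡ v) → ¬ (E u v) → K u v ≈ 0#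
    π-pos    : ∀ u → 0# < π u
    π-sum    : sumF π ≈ 1#
    π-stat   : ∀ v → sumF (λ u → π u * K u v) ≈ π v

module _ {F : OrderedField} {N : ℕ} (G : MarkovGraph F N) where
  open OrderedField F
  open MarkovGraph G

  φ : Fin N → Fin N → Carrier
  φ u v = K u v * π u

  -- A labelling f : V → Fin m encodes the subsets Q_j = f⁻¹(j).
  πQ : ∀ {m} → (Fin N → Fin m) → Fin m → Carrier
  πQ f j = sumF (λ u → if does (f u ≟ j) then π u else 0#)

  ∂Q : ∀ {m} → (Fin N → Fin m) → Fin m → Carrier
  ∂Q f j = sumF (λ u → sumF (λ v →
             if does (f u ≟ j) then (if does (f v ≟ j) then 0# else φ u v) else 0#))

  -- A family of n pairwise disjoint subsets Q_1..Q_n is encoded by a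
  -- labelling f : V → Fin (suc n): Q_i = f⁻¹(suc i), label zero = "in no Q_i".
  -- Its objective (1/n) Σ_i ∂(Q_i)/π(Q_i):
  value : ∀ n → (Fin N → Fin (suc n)) → Carrier
  value n f = (fromℕ n ⁻¹) * sumF (λ (i : Fin n) → ∂Q f (suc i) * (πQ f (suc i) ⁻¹))

  allFuns : ∀ N' m → List (Fin N' → Fin m)
  allFuns zero     m = [ (λ ()) ]
  allFuns (suc N') m = concatMap (λ f → map (λ j → cons j f) (allFin m)) (allFuns N' m)
    where
    cons : ∀ {A : Set} → A → (Fin N' → A) → Fin (suc N') → A
    cons j f zero    = j
    cons j f (suc u) = f u

  families : ∀ n → List (Fin N → Fin (suc n))
  families n = filter (λ f → all? (λ i → any? (λ u → f u ≟ suc i))) (allFuns N (suc n))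

  partitions : ∀ n → List (Fin N → Fin n)
  partitions n = filter (λ g → all? (λ i → any? (λ u → g u ≟ i))) (allFuns N n)

  ι : ℕ → Carrier
  ι n = minimumL (map (value n) (families n))

  ι~ : ℕ → Carrier
  ι~ n = minimumL (map (λ g → value n (λ u → suc (g u))) (partitions n))

module Submission where

-- Each part of the corollary is then an explicit construction from an optimum:
--   (a) a partition is a family; adding the uncovered vertices to Q_1 raises
--       its ratio by at most 1;
--   (d) deleting the block of largest ratio does not increase the average;
--   (b) for two sets Q_1, Q_2, the partition {Q, V∖Q}, Q the set of smaller
--       boundary, is at least as good;
--   (c) for an optimal partition into n+1 blocks, an averaging identity
--       (PairAveraging) yields two blocks whose merger (Blocks, MergeLabels)
--       gives the bound.

open import Defs
open import Data.Nat as ℕ using (ℕ; zero; suc; s≤s; z≤n)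
open import Data.Fin as Fin using (Fin; zero; suc; punchIn; punchOut)
import Data.Fin.Properties as FinP
open import Data.Fin.Properties using (all?; any?)
open import Data.Bool using (Bool; true; false; if_then_else_; not; _∨_)
open import Data.Bool.Properties using (∨-zeroʳ; ∨-identityʳ)
open import Data.Integer as ℤ using (ℤ; +_; -[1+_])
open import Data.Integer.Base using (_◃_)
open import Algebra.Bundles using (CommutativeRing)
import Data.Integer.Properties as ℤP
import Data.Sign as Sign
import Data.Maybe as Maybe
open import Data.Product using (_×_; _,_; proj₁; proj₂; ∃; ∃₂)
open import Data.Sum using (inj₁; inj₂)
open import Data.Empty using (⊥; ⊥-elim)
open import Data.List using ([]; _∷_)
open import Data.List.Relation.Unary.Any as Any using (Any; here; there)
import Data.List.Relation.Unary.Any.Properties as AnyP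
open import Data.List.Membership.Propositional using (_∈_; find)
open import Data.List.Membership.Propositional.Properties
  using (∈-map⁺; ∈-map⁻; ∈-filter⁺; ∈-filter⁻; ∈-allFin)
open import Relation.Nullary using (does; yes; no; ¬?; _×-dec_)
open import Relation.Nullary.Decidable using (dec⇒maybe; dec-true; dec-false)
open import Relation.Binary.PropositionalEquality as P using (_≡_; _≢_; _≗_)
open import Algebra.Solver.Ring.AlmostCommutativeRing
  using (AlmostCommutativeRing; fromCommutativeRing; _-Raw-AlmostCommutative⟶_)

does-⇔ : ∀ {m k} (a b : Fin m) (c d : Fin k) → (a ≡ b → c ≡ d) → (c ≡ d → a ≡ b) →
  does (a Fin.≟ b) ≡ does (c Fin.≟ d)
does-⇔ a b c d to from with a Fin.≟ b | c Fin.≟ d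
... | yes _   | yes _   = P.refl
... | no  _   | no  _   = P.refl
... | yes a≡b | no  c≢d = ⊥-elim (c≢d (to a≡b))
... | no  a≢b | yes c≡d = ⊥-elim (a≢b (from c≡d))

does-sym : ∀ {m} (i j : Fin m) → does (i Fin.≟ j) ≡ does (j Fin.≟ i)
does-sym i j = does-⇔ i j j i P.sym P.sym

punchOut≡⇒ : ∀ {m} {i x : Fin (suc m)} (i≢x : i ≢ x) y → punchOut i≢x ≡ y → x ≡ punchIn i y
punchOut≡⇒ {i = i} i≢x y out≡y = P.trans (P.sym (FinP.punchIn-punchOut i≢x)) (P.cong (punchIn i) out≡y)

≡punchIn⇒ : ∀ {m} {i x : Fin (suc m)} (i≢x : i ≢ x) y → x ≡ punchIn i y → punchOut i≢x ≡ y
≡punchIn⇒ {i = i} i≢x y x≡in = FinP.punchIn-injective i _ _ (P.trans (FinP.punchIn-punchOut i≢x) x≡in)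

module FieldFacts (F : OrderedField) where
  open OrderedField F
  open import Algebra.Properties.Ring ring
    using (-‿distribˡ-*; -‿distribʳ-*; -‿involutive; -0#≈0#; -‿+-comm)
  open import Algebra.Properties.Semiring.Mult semiring
    using (×-homo-+; ×1-homo-*) renaming (_×_ to _·_)
  open import Relation.Binary.Reasoning.Setoid setoid

  fromℕ≡· : ∀ n → fromℕ n ≡ n · 1#
  fromℕ≡· zero    = P.refl
  fromℕ≡· (suc n) = P.cong (λ x → 1# + x) (fromℕ≡· n)

  fromℕ-+ : ∀ m n → fromℕ (m ℕ.+ n) ≈ fromℕ m + fromℕ n
  fromℕ-+ m n rewrite fromℕ≡· (m ℕ.+ n) | fromℕ≡· m | fromℕ≡· n = ×-homo-+ 1# m n

  fromℕ-* : ∀ m n → fromℕ (m ℕ.* n) ≈ fromℕ m * fromℕ n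
  fromℕ-* m n rewrite fromℕ≡· (m ℕ.* n) | fromℕ≡· m | fromℕ≡· n = ×1-homo-* m n

  -- The ring homomorphism ℤ → F; it lets the stdlib ring solver (with integer
  -- coefficients) normalise polynomial identities in F.
  ⟦_⟧ℤ : ℤ → Carrier
  ⟦ + n ⟧ℤ      = fromℕ n
  ⟦ -[1+ n ] ⟧ℤ = - fromℕ (suc n)

  ⟦-⟧ℤ : ∀ i → ⟦ ℤ.- i ⟧ℤ ≈ - ⟦ i ⟧ℤ
  ⟦-⟧ℤ (+ zero)  = sym -0#≈0#
  ⟦-⟧ℤ (+ suc n) = refl
  ⟦-⟧ℤ -[1+ n ]  = sym (-‿involutive _)

  shift-sub : ∀ a b → a - b ≈ (1# + a) - (1# + b)
  shift-sub a b = begin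
    a - b                    ≈⟨ sym (+-identityˡ _) ⟩
    0# + (a - b)             ≈⟨ +-congʳ (sym (-‿inverseʳ 1#)) ⟩
    (1# - 1#) + (a - b)      ≈⟨ +-assoc _ _ _ ⟩
    1# + (- 1# + (a - b))    ≈⟨ +-congˡ (sym (+-assoc _ _ _)) ⟩
    1# + ((- 1# + a) - b)    ≈⟨ +-congˡ (+-congʳ (+-comm _ _)) ⟩
    1# + ((a - 1#) - b)      ≈⟨ +-congˡ (+-assoc _ _ _) ⟩
    1# + (a + (- 1# - b))    ≈⟨ +-congˡ (+-congˡ (-‿+-comm _ _)) ⟩
    1# + (a - (1# + b))      ≈⟨ sym (+-assoc _ _ _) ⟩
    (1# + a) - (1# + b)      ∎

  ⟦⊖⟧ℤ : ∀ m n → ⟦ m ℤ.⊖ n ⟧ℤ ≈ fromℕ m - fromℕ n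
  ⟦⊖⟧ℤ zero    zero    = sym (-‿inverseʳ _)
  ⟦⊖⟧ℤ zero    (suc n) = sym (+-identityˡ _)
  ⟦⊖⟧ℤ (suc m) zero    = trans (sym (+-identityʳ _)) (+-congˡ (sym -0#≈0#))
  ⟦⊖⟧ℤ (suc m) (suc n) = begin
    ⟦ suc m ℤ.⊖ suc n ⟧ℤ  ≡⟨ P.cong ⟦_⟧ℤ (ℤP.[1+m]⊖[1+n]≡m⊖n m n) ⟩
    ⟦ m ℤ.⊖ n ⟧ℤ          ≈⟨ ⟦⊖⟧ℤ m n ⟩
    fromℕ m - fromℕ n     ≈⟨ shift-sub _ _ ⟩
    fromℕ (suc m) - fromℕ (suc n) ∎

  ⟦+⟧ℤ : ∀ i j → ⟦ i ℤ.+ j ⟧ℤ ≈ ⟦ i ⟧ℤ + ⟦ j ⟧ℤ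
  ⟦+⟧ℤ -[1+ m ] -[1+ n ] = begin
    - (1# + (1# + fromℕ (m ℕ.+ n)))     ≈⟨ -‿cong (+-congˡ (+-congˡ (fromℕ-+ m n))) ⟩
    - (1# + (1# + (fromℕ m + fromℕ n))) ≈⟨ -‿cong regroup ⟩
    - ((1# + fromℕ m) + (1# + fromℕ n)) ≈⟨ sym (-‿+-comm _ _) ⟩
    - (1# + fromℕ m) - (1# + fromℕ n)   ∎
    where
    regroup : 1# + (1# + (fromℕ m + fromℕ n)) ≈ (1# + fromℕ m) + (1# + fromℕ n)
    regroup = begin
      1# + (1# + (fromℕ m + fromℕ n)) ≈⟨ +-congˡ (+-congˡ (+-comm _ _)) ⟩
      1# + (1# + (fromℕ n + fromℕ m)) ≈⟨ +-congˡ (sym (+-assoc _ _ _)) ⟩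
      1# + ((1# + fromℕ n) + fromℕ m) ≈⟨ +-congˡ (+-comm _ _) ⟩
      1# + (fromℕ m + (1# + fromℕ n)) ≈⟨ sym (+-assoc _ _ _) ⟩
      (1# + fromℕ m) + (1# + fromℕ n) ∎
  ⟦+⟧ℤ -[1+ m ] (+ n)    = trans (⟦⊖⟧ℤ n (suc m)) (+-comm _ _)
  ⟦+⟧ℤ (+ m)    -[1+ n ] = ⟦⊖⟧ℤ m (suc n)
  ⟦+⟧ℤ (+ m)    (+ n)    = fromℕ-+ m n

  ⟦+◃⟧ℤ : ∀ k → ⟦ Sign.+ ◃ k ⟧ℤ ≈ fromℕ k
  ⟦+◃⟧ℤ zero    = refl
  ⟦+◃⟧ℤ (suc k) = refl

  ⟦-◃⟧ℤ : ∀ k → ⟦ Sign.- ◃ k ⟧ℤ ≈ - fromℕ k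
  ⟦-◃⟧ℤ zero    = sym -0#≈0#
  ⟦-◃⟧ℤ (suc k) = refl

  ⟦*⟧ℤ : ∀ i j → ⟦ i ℤ.* j ⟧ℤ ≈ ⟦ i ⟧ℤ * ⟦ j ⟧ℤ
  ⟦*⟧ℤ (+ m) (+ n) = trans (⟦+◃⟧ℤ (m ℕ.* n)) (fromℕ-* m n)
  ⟦*⟧ℤ (+ m) -[1+ n ] =
    trans (⟦-◃⟧ℤ (m ℕ.* suc n)) (trans (-‿cong (fromℕ-* m (suc n))) (-‿distribʳ-* _ _))
  ⟦*⟧ℤ -[1+ m ] (+ n) =
    trans (⟦-◃⟧ℤ (suc m ℕ.* n)) (trans (-‿cong (fromℕ-* (suc m) n)) (-‿distribˡ-* _ _))
  ⟦*⟧ℤ -[1+ m ] -[1+ n ] = begin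
    ⟦ Sign.+ ◃ (suc m ℕ.* suc n) ⟧ℤ  ≈⟨ ⟦+◃⟧ℤ (suc m ℕ.* suc n) ⟩
    fromℕ (suc m ℕ.* suc n)          ≈⟨ fromℕ-* (suc m) (suc n) ⟩
    a * b                            ≈⟨ sym (-‿involutive _) ⟩
    - (- (a * b))                    ≈⟨ -‿cong (-‿distribˡ-* _ _) ⟩
    - (- a * b)                      ≈⟨ -‿distribʳ-* _ _ ⟩
    - a * - b                        ∎
    where
    a = fromℕ (suc m)
    b = fromℕ (suc n)

  ℤ⟶F : CommutativeRing.rawRing ℤP.+-*-commutativeRing
          -Raw-AlmostCommutative⟶ fromCommutativeRing commutativeRing
  ℤ⟶F = record
    { ⟦_⟧    = ⟦_⟧ℤ
    ; +-homo = ⟦+⟧ℤ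
    ; *-homo = ⟦*⟧ℤ
    ; -‿homo = ⟦-⟧ℤ
    ; 0-homo = refl
    ; 1-homo = +-identityʳ 1#
    }

  open import Algebra.Solver.Ring _ _ ℤ⟶F
    (λ i j → Maybe.map (λ i≡j → reflexive (P.cong ⟦_⟧ℤ i≡j)) (dec⇒maybe (i ℤ.≟ j))) public

  open import Relation.Binary.Structures using (IsDecTotalOrder)
  module O = IsDecTotalOrder isDecTotalOrder
  open O public using () renaming
    (refl to ≤-refl; trans to ≤-trans; reflexive to ≤-reflexive; antisym to ≤-antisym)

  ≤-resp : ∀ {x y x' y'} → x ≈ x' → y ≈ y' → x ≤ y → x' ≤ y'
  ≤-resp x≈x' y≈y' x≤y = ≤-trans (≤-reflexive (sym x≈x')) (≤-trans x≤y (≤-reflexive y≈y'))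

  +-monoʳ-≤ : ∀ {x y} z → x ≤ y → z + x ≤ z + y
  +-monoʳ-≤ z x≤y = ≤-resp (+-comm _ _) (+-comm _ _) (+-monoˡ-≤ z x≤y)

  +-mono-≤ : ∀ {a b c d} → a ≤ b → c ≤ d → a + c ≤ b + d
  +-mono-≤ {b = b} {c = c} a≤b c≤d = ≤-trans (+-monoˡ-≤ c a≤b) (+-monoʳ-≤ b c≤d)

  ≤-+ʳ : ∀ {a b} → 0# ≤ b → a ≤ a + b
  ≤-+ʳ {a} 0≤b = ≤-resp (+-identityʳ a) refl (+-monoʳ-≤ a 0≤b)

  ≤-+ˡ : ∀ {a b} → 0# ≤ b → a ≤ b + a
  ≤-+ˡ {a} 0≤b = ≤-resp (+-identityˡ a) refl (+-monoˡ-≤ a 0≤b)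

  neg-antitone : ∀ {x y} → x ≤ y → - y ≤ - x
  neg-antitone {x} {y} x≤y = ≤-resp (solve 2 (λ x y → x :+ (:- x :- y) := :- y) refl x y)
                                     (solve 2 (λ x y → y :+ (:- x :- y) := :- x) refl x y)
                                     (+-monoˡ-≤ (- x - y) x≤y)

  ≤⇒0≤- : ∀ {x y} → x ≤ y → 0# ≤ y - x
  ≤⇒0≤- {x} x≤y = ≤-resp (-‿inverseʳ x) refl (+-monoˡ-≤ (- x) x≤y)

  0≤-⇒≤ : ∀ {x y} → 0# ≤ y - x → x ≤ y
  0≤-⇒≤ {x} {y} 0≤y-x =
    ≤-resp (+-identityˡ x) (solve 2 (λ x y → (y :- x) :+ x := y) refl x y) (+-monoˡ-≤ x 0≤y-x)

  *-monoˡ-≤ : ∀ {x y} c → 0# ≤ c → x ≤ y → c * x ≤ c * y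
  *-monoˡ-≤ {x} {y} c 0≤c x≤y = 0≤-⇒≤ (≤-resp refl
    (solve 3 (λ c x y → c :* (y :- x) := c :* y :- c :* x) refl c x y)
    (*-nonneg 0≤c (≤⇒0≤- x≤y)))

  *-monoʳ-≤ : ∀ {x y} c → 0# ≤ c → x ≤ y → x * c ≤ y * c
  *-monoʳ-≤ c 0≤c x≤y = ≤-resp (*-comm _ _) (*-comm _ _) (*-monoˡ-≤ c 0≤c x≤y)

  -- 1 > 0: otherwise 0 ≤ -1 and then 0 ≤ (-1)(-1) = 1.
  0≤1 : 0# ≤ 1#
  0≤1 with O.total 0# 1#
  ... | inj₁ 0≤1 = 0≤1
  ... | inj₂ 1≤0 = ≤-resp refl (trans (solve 1 (λ x → :- x :* :- x := x :* x) refl 1#) (*-identityʳ 1#))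
                          (*-nonneg 0≤-1 0≤-1)
    where
    0≤-1 : 0# ≤ - 1#
    0≤-1 = ≤-resp -0#≈0# refl (neg-antitone 1≤0)

  <-≤-trans : ∀ {a b c} → a < b → b ≤ c → a < c
  <-≤-trans (a≤b , a≉b) b≤c =
    ≤-trans a≤b b≤c , λ a≈c → a≉b (≤-antisym a≤b (≤-resp refl (sym a≈c) b≤c))

  <-respʳ : ∀ {a b c} → a < b → b ≈ c → a < c
  <-respʳ a<b b≈c = <-≤-trans a<b (≤-reflexive b≈c)

  0<1 : 0# < 1#
  0<1 = 0≤1 , 0≉1

  fromℕ-nonneg : ∀ n → 0# ≤ fromℕ n
  fromℕ-nonneg zero    = ≤-refl
  fromℕ-nonneg (suc n) = ≤-resp (+-identityˡ 0#) refl (+-mono-≤ 0≤1 (fromℕ-nonneg n))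

  fromℕ-pos : ∀ n → 0# < fromℕ (suc n)
  fromℕ-pos n = <-≤-trans 0<1 (≤-+ʳ (fromℕ-nonneg n))

  ⁻¹-inverseʳ⁺ : ∀ {p} → 0# < p → p * p ⁻¹ ≈ 1#
  ⁻¹-inverseʳ⁺ (_ , 0≉p) = ⁻¹-inverseʳ _ (λ p≈0 → 0≉p (sym p≈0))

  ⁻¹-inverseˡ⁺ : ∀ {p} → 0# < p → p ⁻¹ * p ≈ 1#
  ⁻¹-inverseˡ⁺ 0<p = trans (*-comm _ _) (⁻¹-inverseʳ⁺ 0<p)

  ⁻¹-unique : ∀ {x y} → 0# < x → x * y ≈ 1# → x ⁻¹ ≈ y
  ⁻¹-unique {x} {y} 0<x xy≈1 = begin
    x ⁻¹            ≈⟨ sym (*-identityʳ _) ⟩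
    x ⁻¹ * 1#       ≈⟨ *-congˡ (sym xy≈1) ⟩
    x ⁻¹ * (x * y)  ≈⟨ sym (*-assoc _ _ _) ⟩
    (x ⁻¹ * x) * y  ≈⟨ *-congʳ (⁻¹-inverseˡ⁺ 0<x) ⟩
    1# * y          ≈⟨ *-identityˡ y ⟩
    y               ∎

  ⁻¹-cong : ∀ {x y} → 0# < x → x ≈ y → x ⁻¹ ≈ y ⁻¹
  ⁻¹-cong {x} {y} 0<x x≈y = sym (⁻¹-unique (<-respʳ 0<x x≈y) (begin
    y * x ⁻¹  ≈⟨ *-congʳ (sym x≈y) ⟩
    x * x ⁻¹  ≈⟨ ⁻¹-inverseʳ⁺ 0<x ⟩
    1#        ∎))

  ⁻¹-nonneg : ∀ {p} → 0# < p → 0# ≤ p ⁻¹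
  ⁻¹-nonneg {p} 0<p with O.total 0# (p ⁻¹)
  ... | inj₁ 0≤p⁻¹ = 0≤p⁻¹
  ... | inj₂ p⁻¹≤0 = ⊥-elim (0≉1 (≤-antisym 0≤1
        (≤-resp (⁻¹-inverseʳ⁺ 0<p) (zeroʳ p) (*-monoˡ-≤ p (proj₁ 0<p) p⁻¹≤0))))

  *-pos : ∀ {x y} → 0# < x → 0# < y → 0# < (x * y)
  *-pos {x} {y} 0<x 0<y = *-nonneg (proj₁ 0<x) (proj₁ 0<y) , λ 0≈xy → 0≉1 (begin
    0#
      ≈⟨ sym (zeroˡ _) ⟩
    0# * (y ⁻¹ * x ⁻¹)
      ≈⟨ *-congʳ 0≈xy ⟩
    (x * y) * (y ⁻¹ * x ⁻¹)
      ≈⟨ solve 4 (λ x y y' x' → (x :* y) :* (y' :* x') := (x :* x') :* (y :* y'))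
          refl x y (y ⁻¹) (x ⁻¹) ⟩
    (x * x ⁻¹) * (y * y ⁻¹)
      ≈⟨ *-cong (⁻¹-inverseʳ⁺ 0<x) (⁻¹-inverseʳ⁺ 0<y) ⟩
    1# * 1#
      ≈⟨ *-identityˡ 1# ⟩
    1#                         ∎)

  *-⁻¹-cancel : ∀ {p} x → 0# < p → x * p * p ⁻¹ ≈ x
  *-⁻¹-cancel x 0<p = trans (*-assoc _ _ _) (trans (*-congˡ (⁻¹-inverseʳ⁺ 0<p)) (*-identityʳ x))

  ⁻¹-*-cancel : ∀ {p} x → 0# < p → x * p ⁻¹ * p ≈ x
  ⁻¹-*-cancel x 0<p = trans (*-assoc _ _ _) (trans (*-congˡ (⁻¹-inverseˡ⁺ 0<p)) (*-identityʳ x))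

  cross-≤ : ∀ {a b x y} → 0# < a → 0# < b → x * b ≤ y * a → x * a ⁻¹ ≤ y * b ⁻¹
  cross-≤ {a} {b} {x} {y} 0<a 0<b xb≤ya =
    ≤-resp lhs rhs (*-monoʳ-≤ (a ⁻¹ * b ⁻¹) (*-nonneg (⁻¹-nonneg 0<a) (⁻¹-nonneg 0<b)) xb≤ya)
    where
    lhs : x * b * (a ⁻¹ * b ⁻¹) ≈ x * a ⁻¹
    lhs = trans (solve 4 (λ x b a' b' → x :* b :* (a' :* b') := x :* a' :* (b :* b')) refl x b (a ⁻¹) (b ⁻¹))
                (trans (*-congˡ (⁻¹-inverseʳ⁺ 0<b)) (*-identityʳ _))
    rhs : y * a * (a ⁻¹ * b ⁻¹) ≈ y * b ⁻¹
    rhs = trans (solve 4 (λ y a a' b' → y :* a :* (a' :* b') := y :* b' :* (a :* a')) refl y a (a ⁻¹) (b ⁻¹))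
                (trans (*-congˡ (⁻¹-inverseʳ⁺ 0<a)) (*-identityʳ _))

  sumF-cong : ∀ {m} {f g : Fin m → Carrier} → (∀ i → f i ≈ g i) → sumF f ≈ sumF g
  sumF-cong {zero}  _   = refl
  sumF-cong {suc m} f≈g = +-cong (f≈g zero) (sumF-cong (λ i → f≈g (suc i)))

  sumF-mono : ∀ {m} {f g : Fin m → Carrier} → (∀ i → f i ≤ g i) → sumF f ≤ sumF g
  sumF-mono {zero}  _   = ≤-refl
  sumF-mono {suc m} f≤g = +-mono-≤ (f≤g zero) (sumF-mono (λ i → f≤g (suc i)))

  sumF-0 : ∀ {m} → sumF {m} (λ _ → 0#) ≈ 0#
  sumF-0 {zero}  = refl
  sumF-0 {suc m} = trans (+-identityˡ _) (sumF-0 {m})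

  sumF-+ : ∀ {m} (f g : Fin m → Carrier) → sumF (λ i → f i + g i) ≈ sumF f + sumF g
  sumF-+ {zero}  f g = sym (+-identityˡ 0#)
  sumF-+ {suc m} f g = trans (+-congˡ (sumF-+ (λ i → f (suc i)) (λ i → g (suc i))))
    (solve 4 (λ a b c d → (a :+ b) :+ (c :+ d) := (a :+ c) :+ (b :+ d)) refl _ _ _ _)

  sumF-neg : ∀ {m} (f : Fin m → Carrier) → sumF (λ i → - f i) ≈ - sumF f
  sumF-neg {zero}  f = sym -0#≈0#
  sumF-neg {suc m} f = trans (+-congˡ (sumF-neg (λ i → f (suc i)))) (-‿+-comm _ _)

  sumF-- : ∀ {m} (f g : Fin m → Carrier) → sumF (λ i → f i - g i) ≈ sumF f - sumF g
  sumF-- f g = trans (sumF-+ f (λ i → - g i)) (+-congˡ (sumF-neg g))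

  sumF-*ˡ : ∀ {m} c (f : Fin m → Carrier) → sumF (λ i → c * f i) ≈ c * sumF f
  sumF-*ˡ {zero}  c f = sym (zeroʳ c)
  sumF-*ˡ {suc m} c f = trans (+-congˡ (sumF-*ˡ c (λ i → f (suc i)))) (sym (distribˡ _ _ _))

  sumF-*ʳ : ∀ {m} c (f : Fin m → Carrier) → sumF (λ i → f i * c) ≈ sumF f * c
  sumF-*ʳ c f = trans (sumF-cong (λ i → *-comm (f i) c)) (trans (sumF-*ˡ c f) (*-comm _ _))

  sumF-const : ∀ {m} c → sumF {m} (λ _ → c) ≈ fromℕ m * c
  sumF-const {zero}  c = sym (zeroˡ c)
  sumF-const {suc m} c = trans (+-cong (sym (*-identityˡ c)) (sumF-const {m} c)) (sym (distribʳ _ _ _))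

  sumF-swap : ∀ {m k} (f : Fin m → Fin k → Carrier) →
    sumF (λ i → sumF (λ j → f i j)) ≈ sumF (λ j → sumF (λ i → f i j))
  sumF-swap {zero}  {k} f = sym (sumF-0 {k})
  sumF-swap {suc m}     f = trans (+-congˡ (sumF-swap (λ i j → f (suc i) j)))
    (sym (sumF-+ (λ j → f zero j) (λ j → sumF (λ i → f (suc i) j))))

  sumF-pick : ∀ {m} (b : Fin m) (x : Fin m → Carrier) →
    sumF (λ j → if does (b Fin.≟ j) then x j else 0#) ≈ x b
  sumF-pick {suc m} zero    x = trans (+-congˡ (sumF-0 {m})) (+-identityʳ _)
  sumF-pick {suc m} (suc b) x = trans (+-identityˡ _) (sumF-pick b (λ j → x (suc j)))

  sumF-extract : ∀ {m} (k : Fin (suc m)) (a : Fin (suc m) → Carrier) →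
    sumF a ≈ a k + sumF (λ i → a (punchIn k i))
  sumF-extract zero    a = refl
  sumF-extract {suc m} (suc k) a = trans (+-congˡ (sumF-extract k (λ i → a (suc i))))
    (solve 3 (λ x y z → x :+ (y :+ z) := y :+ (x :+ z)) refl (a zero) (a (suc k)) _)

  sumF-nonneg : ∀ {m} {f : Fin m → Carrier} → (∀ i → 0# ≤ f i) → 0# ≤ sumF f
  sumF-nonneg {m} 0≤f = ≤-resp (sumF-0 {m}) refl (sumF-mono 0≤f)

  sumF-nonpos : ∀ {m} {f : Fin m → Carrier} → (∀ i → f i ≤ 0#) → sumF f ≤ 0#
  sumF-nonpos {m} f≤0 = ≤-resp refl (sumF-0 {m}) (sumF-mono f≤0)

  sumF-bound : ∀ {m} {f : Fin m → Carrier} c → (∀ i → f i ≤ c) → sumF f ≤ fromℕ m * c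
  sumF-bound {m} c f≤c = ≤-resp refl (sumF-const {m} c) (sumF-mono f≤c)

  sumF-≤-term : ∀ {m} {f : Fin (suc m) → Carrier} → (∀ i → f i ≤ 0#) → ∀ k → sumF f ≤ f k
  sumF-≤-term {f = f} f≤0 k = ≤-resp (sym (sumF-extract k f)) (+-identityʳ _)
    (+-monoʳ-≤ (f k) (sumF-nonpos (λ i → f≤0 (punchIn k i))))

  sumF-≥-term : ∀ {m} {f : Fin m → Carrier} → (∀ i → 0# ≤ f i) → ∀ k → f k ≤ sumF f
  sumF-≥-term 0≤f zero    = ≤-+ʳ (sumF-nonneg (λ i → 0≤f (suc i)))
  sumF-≥-term 0≤f (suc k) = ≤-trans (sumF-≥-term (λ i → 0≤f (suc i)) k) (≤-+ˡ (0≤f zero))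

  min≤l : ∀ x y → min x y ≤ x
  min≤l x y with x ≤? y
  ... | yes _   = ≤-refl
  ... | no  x≰y with O.total x y
  ...   | inj₁ x≤y = ⊥-elim (x≰y x≤y)
  ...   | inj₂ y≤x = y≤x

  min≤r : ∀ x y → min x y ≤ y
  min≤r x y with x ≤? y
  ... | yes x≤y = x≤y
  ... | no  _   = ≤-refl

  minimumL-≤ : ∀ {x xs} → x ∈ xs → minimumL xs ≤ x
  minimumL-≤ {xs = x ∷ []}     (here P.refl) = ≤-refl
  minimumL-≤ {xs = x ∷ y ∷ ys} (here P.refl) = min≤l x (minimumL (y ∷ ys))
  minimumL-≤ {xs = x ∷ y ∷ ys} (there x∈)    = ≤-trans (min≤r x (minimumL (y ∷ ys))) (minimumL-≤ x∈)

  minimumL-∈ : ∀ {x xs} → x ∈ xs → minimumL xs ∈ xs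
  minimumL-∈ {xs = y ∷ ys} _ = go y ys
    where
    go : ∀ y ys → minimumL (y ∷ ys) ∈ y ∷ ys
    go y []       = here P.refl
    go y (z ∷ zs) with y ≤? minimumL (z ∷ zs)
    ... | yes _ = here P.refl
    ... | no  _ = there (go z zs)

module Cuts {F : OrderedField} {N : ℕ} (G : MarkovGraph F N) where
  open OrderedField F
  open MarkovGraph G
  open FieldFacts F
  open import Relation.Binary.Reasoning.Setoid setoid

  Subset : Set
  Subset = Fin N → Bool

  ∁ : Subset → Subset
  ∁ S u = not (S u)

  mass : Subset → Carrier
  mass S = sumF (λ u → if S u then π u else 0#)

  flow : Subset → Subset → Carrier
  flow S T = sumF (λ u → sumF (λ v → if S u then (if T v then φ G u v else 0#) else 0#))

  boundary : Subset → Carrier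
  boundary S = sumF (λ u → sumF (λ v → if S u then (if S v then 0# else φ G u v) else 0#))

  ratio : Subset → Carrier
  ratio S = boundary S * mass S ⁻¹

  -- The i-th block f⁻¹(i) of a labelling f; πQ and ∂Q of Defs are
  -- definitionally mass and boundary of blocks.
  block : ∀ {m} → (Fin N → Fin m) → Fin m → Subset
  block f j u = does (f u Fin.≟ j)

  φ-nonneg : ∀ u v → 0# ≤ φ G u v
  φ-nonneg u v = *-nonneg (K-nonneg u v) (proj₁ (π-pos u))

  φ-row : ∀ u → sumF (λ v → φ G u v) ≈ π u
  φ-row u = trans (sumF-*ʳ (π u) (K u)) (trans (*-congʳ (K-rows u)) (*-identityˡ _))

  φ-col : ∀ v → sumF (λ u → φ G u v) ≈ π v
  φ-col v = trans (sumF-cong (λ u → *-comm (K u v) (π u))) (π-stat v)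

  if-nonneg : ∀ b {x} → 0# ≤ x → 0# ≤ (if b then x else 0#)
  if-nonneg true  0≤x = 0≤x
  if-nonneg false _   = ≤-refl

  if-cong : ∀ b {x y} → x ≈ y → (if b then x else 0#) ≈ (if b then y else 0#)
  if-cong true  x≈y = x≈y
  if-cong false _   = refl

  if-sumF : ∀ {m} b (f : Fin m → Carrier) → (if b then sumF f else 0#) ≈ sumF (λ v → if b then f v else 0#)
  if-sumF     true  f = refl
  if-sumF {m} false f = sym (sumF-0 {m})

  mass-nonneg : ∀ S → 0# ≤ mass S
  mass-nonneg S = sumF-nonneg (λ u → if-nonneg (S u) (proj₁ (π-pos u)))

  boundary-nonneg : ∀ S → 0# ≤ boundary S
  boundary-nonneg S = sumF-nonneg (λ u → sumF-nonneg (λ v →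
    if-nonneg (S u) (leaving (S v) (φ-nonneg u v))))
    where
    leaving : ∀ b {x} → 0# ≤ x → 0# ≤ (if b then 0# else x)
    leaving true  _   = ≤-refl
    leaving false 0≤x = 0≤x

  -- Only mass of S can leave S.
  boundary≤mass : ∀ S → boundary S ≤ mass S
  boundary≤mass S = sumF-mono row
    where
    leaving≤ : ∀ b {x} → 0# ≤ x → (if b then 0# else x) ≤ x
    leaving≤ true  0≤x = 0≤x
    leaving≤ false _   = ≤-refl
    row : ∀ u → sumF (λ v → if S u then (if S v then 0# else φ G u v) else 0#) ≤ (if S u then π u else 0#)
    row u with S u
    ... | true  = ≤-trans (sumF-mono (λ v → leaving≤ (S v) (φ-nonneg u v))) (≤-reflexive (φ-row u))
    ... | false = ≤-reflexive (sumF-0 {N})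

  mass-cong : ∀ {S T} → S ≗ T → mass S ≈ mass T
  mass-cong S≡T = sumF-cong (λ u → reflexive (P.cong (λ b → if b then π u else 0#) (S≡T u)))

  boundary-cong : ∀ {S T} → S ≗ T → boundary S ≈ boundary T
  boundary-cong S≡T = sumF-cong (λ u → sumF-cong (λ v → reflexive
    (P.cong₂ (λ a b → if a then (if b then 0# else φ G u v) else 0#) (S≡T u) (S≡T v))))

  ratio-cong : ∀ {S T} → 0# < mass S → S ≗ T → ratio S ≈ ratio T
  ratio-cong 0<πS S≡T = *-cong (boundary-cong S≡T) (⁻¹-cong 0<πS (mass-cong S≡T))

  mass-pos : ∀ S u → S u ≡ true → 0# < mass S
  mass-pos S u Su = <-≤-trans (<-respʳ (π-pos u) (reflexive (P.cong (λ b → if b then π u else 0#) (P.sym Su))))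
    (sumF-≥-term (λ i → if-nonneg (S i) (proj₁ (π-pos i))) u)

  mass-mono : ∀ S T → (∀ u → S u ≡ true → T u ≡ true) → mass S ≤ mass T
  mass-mono S T S⊆T = sumF-mono pointwise
    where
    pointwise : ∀ u → (if S u then π u else 0#) ≤ (if T u then π u else 0#)
    pointwise u with S u | T u | S⊆T u
    ... | true  | true  | _    = ≤-refl
    ... | true  | false | S⊆Tu with S⊆Tu P.refl
    ...   | ()
    pointwise u | false | t | _ = if-nonneg t (proj₁ (π-pos u))

  ratio-nonneg : ∀ S → 0# < mass S → 0# ≤ ratio S
  ratio-nonneg S 0<πS = *-nonneg (boundary-nonneg S) (⁻¹-nonneg 0<πS)

  ratio≤1 : ∀ S → 0# < mass S → ratio S ≤ 1#
  ratio≤1 S 0<πS = ≤-resp refl (⁻¹-inverseʳ⁺ 0<πS) (*-monoʳ-≤ _ (⁻¹-nonneg 0<πS) (boundary≤mass S))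

  ratio*mass : ∀ S → 0# < mass S → ratio S * mass S ≈ boundary S
  ratio*mass S 0<πS = ⁻¹-*-cancel (boundary S) 0<πS

  mass-out : ∀ S → mass S ≈ flow S S + boundary S
  mass-out S = begin
    mass S
      ≈⟨ sumF-cong (λ u → if-cong (S u) (sym (φ-row u))) ⟩
    sumF (λ u → if S u then sumF (λ v → φ G u v) else 0#)
      ≈⟨ sumF-cong (λ u → if-sumF (S u) (φ G u)) ⟩
    sumF (λ u → sumF (λ v → if S u then φ G u v else 0#))
      ≈⟨ sumF-cong (λ u → sumF-cong (λ v → split (S u) (S v) (φ G u v))) ⟩
    sumF (λ u → sumF (λ v → inside u v + leaving u v))
      ≈⟨ sumF-cong (λ u → sumF-+ (inside u) (leaving u)) ⟩
    sumF (λ u → sumF (inside u) + sumF (leaving u))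
      ≈⟨ sumF-+ (λ u → sumF (inside u)) (λ u → sumF (leaving u)) ⟩
    flow S S + boundary S ∎
    where
    inside leaving : Fin N → Fin N → Carrier
    inside  u v = if S u then (if S v then φ G u v else 0#) else 0#
    leaving u v = if S u then (if S v then 0# else φ G u v) else 0#
    split : ∀ s t x → (if s then x else 0#)
      ≈ (if s then (if t then x else 0#) else 0#) + (if s then (if t then 0# else x) else 0#)
    split true  true  x = sym (+-identityʳ x)
    split true  false x = sym (+-identityˡ x)
    split false t     x = sym (+-identityˡ 0#)

  mass-in : ∀ S → mass S ≈ flow S S + boundary (∁ S)
  mass-in S = begin
    mass S
      ≈⟨ sumF-cong (λ v → if-cong (S v) (sym (φ-col v))) ⟩
    sumF (λ v → if S v then sumF (λ u → φ G u v) else 0#)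
      ≈⟨ sumF-cong (λ v → if-sumF (S v) (λ u → φ G u v)) ⟩
    sumF (λ v → sumF (λ u → if S v then φ G u v else 0#))
      ≈⟨ sym (sumF-swap (λ u v → if S v then φ G u v else 0#)) ⟩
    sumF (λ u → sumF (λ v → if S v then φ G u v else 0#))
      ≈⟨ sumF-cong (λ u → sumF-cong (λ v → split (S u) (S v) (φ G u v))) ⟩
    sumF (λ u → sumF (λ v → inside u v + entering u v))
      ≈⟨ sumF-cong (λ u → sumF-+ (inside u) (entering u)) ⟩
    sumF (λ u → sumF (inside u) + sumF (entering u))
      ≈⟨ sumF-+ (λ u → sumF (inside u)) (λ u → sumF (entering u)) ⟩
    flow S S + boundary (∁ S) ∎
    where
    inside entering : Fin N → Fin N → Carrier
    inside   u v = if S u then (if S v then φ G u v else 0#) else 0#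
    entering u v = if not (S u) then (if not (S v) then 0# else φ G u v) else 0#
    split : ∀ s t x → (if t then x else 0#)
      ≈ (if s then (if t then x else 0#) else 0#) + (if not s then (if not t then 0# else x) else 0#)
    split true  true  x = sym (+-identityʳ x)
    split true  false x = sym (+-identityˡ 0#)
    split false true  x = sym (+-identityˡ x)
    split false false x = sym (+-identityˡ 0#)

  -- Stationarity: as much mass leaves S as enters it.
  boundary-∁ : ∀ S → boundary S ≈ boundary (∁ S)
  boundary-∁ S = begin
    boundary S
      ≈⟨ solve 2 (λ a b → b := :- a :+ (a :+ b)) refl (flow S S) _ ⟩
    - flow S S + (flow S S + boundary S)
      ≈⟨ +-congˡ (trans (sym (mass-out S)) (mass-in S)) ⟩
    - flow S S + (flow S S + boundary (∁ S))
      ≈⟨ solve 2 (λ a b → :- a :+ (a :+ b) := b) refl (flow S S) _ ⟩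
    boundary (∁ S) ∎

module Optima {F : OrderedField} {N : ℕ} (G : MarkovGraph F N) where
  open OrderedField F
  open FieldFacts F
  open Cuts G

  allFuns-complete : ∀ N' m (g : Fin N' → Fin m) → ∃ λ g' → g' ∈ allFuns G N' m × g' ≗ g
  allFuns-complete N' m g = find (listed N' m g)
    where
    listed : ∀ N' m (g : Fin N' → Fin m) → Any (λ g' → g' ≗ g) (allFuns G N' m)
    listed zero    m g = here (λ ())
    listed (suc N') m g with allFuns-complete N' m (λ u → g (suc u))
    ... | g' , g'∈ , g'≗g = AnyP.concatMap⁺ _ (Any.map (λ { P.refl → AnyP.map⁺ (Any.map
            (λ { P.refl → λ { zero → P.refl ; (suc u) → g'≗g u } }) (∈-allFin (g zero))) }) g'∈)

  IsFamily : ∀ n → (Fin N → Fin (suc n)) → Set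
  IsFamily n f = ∀ (i : Fin n) → ∃ λ u → f u ≡ suc i

  IsPartition : ∀ n → (Fin N → Fin n) → Set
  IsPartition n g = ∀ (i : Fin n) → ∃ λ u → g u ≡ i

  asFamily : ∀ {n} → (Fin N → Fin n) → Fin N → Fin (suc n)
  asFamily g u = suc (g u)

  partition⇒family : ∀ n g → IsPartition n g → IsFamily n (asFamily g)
  partition⇒family n g onto i with onto i
  ... | u , gu≡i = u , P.cong suc gu≡i

  block-pos : ∀ {m} (f : Fin N → Fin m) j → (∃ λ u → f u ≡ j) → 0# < mass (block f j)
  block-pos f j (u , fu≡j) = mass-pos (block f j) u (dec-true (f u Fin.≟ j) fu≡j)

  value-cong : ∀ n {f f'} → IsFamily n f → f ≗ f' → value G n f ≈ value G n f'
  value-cong n fam f≗f' = *-congˡ (sumF-cong (λ i →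
    ratio-cong (block-pos _ (suc i) (fam i)) (λ u → P.cong (λ x → does (x Fin.≟ suc i)) (f≗f' u))))

  family-listed : ∀ n f → IsFamily n f → ∃ λ f' → f' ∈ families G n × f' ≗ f
  family-listed n f fam with allFuns-complete N (suc n) f
  ... | f' , f'∈ , f'≗f =
    f' , ∈-filter⁺ (λ f → all? (λ i → any? (λ u → f u Fin.≟ suc i))) f'∈ fam' , f'≗f
    where
    fam' : IsFamily n f'
    fam' i with fam i
    ... | u , fu≡ = u , P.trans (f'≗f u) fu≡

  partition-listed : ∀ n g → IsPartition n g → ∃ λ g' → g' ∈ partitions G n × g' ≗ g
  partition-listed n g onto with allFuns-complete N n g
  ... | g' , g'∈ , g'≗g =
    g' , ∈-filter⁺ (λ g → all? (λ i → any? (λ u → g u Fin.≟ i))) g'∈ onto' , g'≗g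
    where
    onto' : IsPartition n g'
    onto' i with onto i
    ... | u , gu≡ = u , P.trans (g'≗g u) gu≡

  ι-≤ : ∀ n f → IsFamily n f → ι G n ≤ value G n f
  ι-≤ n f fam with family-listed n f fam
  ... | f' , f'∈ , f'≗f = ≤-trans (minimumL-≤ (∈-map⁺ (value G n) f'∈))
                                  (≤-reflexive (sym (value-cong n fam (λ u → P.sym (f'≗f u)))))

  ι~-≤ : ∀ n g → IsPartition n g → ι~ G n ≤ value G n (asFamily g)
  ι~-≤ n g onto with partition-listed n g onto
  ... | g' , g'∈ , g'≗g = ≤-trans (minimumL-≤ (∈-map⁺ (λ g → value G n (asFamily g)) g'∈))
      (≤-reflexive (sym (value-cong n (partition⇒family n g onto) (λ u → P.cong suc (P.sym (g'≗g u))))))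

  ι-attained : ∀ n f₀ → IsFamily n f₀ → ∃ λ f → IsFamily n f × ι G n ≡ value G n f
  ι-attained n f₀ fam₀ with family-listed n f₀ fam₀
  ... | f' , f'∈ , _ with ∈-map⁻ (value G n) (minimumL-∈ (∈-map⁺ (value G n) f'∈))
  ...   | f , f∈ , ι≡ = f , proj₂ (∈-filter⁻ (λ f → all? (λ i → any? (λ u → f u Fin.≟ suc i)))
                                               {xs = allFuns G N (suc n)} f∈) , ι≡

  ι~-attained : ∀ n g₀ → IsPartition n g₀ → ∃ λ g → IsPartition n g × ι~ G n ≡ value G n (asFamily g)
  ι~-attained n g₀ onto₀ with partition-listed n g₀ onto₀
  ... | g' , g'∈ , _
    with ∈-map⁻ (λ g → value G n (asFamily g)) (minimumL-∈ (∈-map⁺ (λ g → value G n (asFamily g)) g'∈))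
  ...   | g , g∈ , ι~≡ = g , proj₂ (∈-filter⁻ (λ g → all? (λ i → any? (λ u → g u Fin.≟ i)))
                                                 {xs = allFuns G N n} g∈) , ι~≡

  -- For 1 ≤ n ≤ N a partition into n blocks exists: u ↦ min(u, n-1).
  clamp : ∀ {M n} → Fin M → Fin (suc n)
  clamp zero                 = zero
  clamp {n = zero}  (suc u)  = zero
  clamp {n = suc n} (suc u)  = suc (clamp u)

  clamp-onto : ∀ {M n} → suc n ℕ.≤ M → (i : Fin (suc n)) → ∃ λ (u : Fin M) → clamp {M} {n} u ≡ i
  clamp-onto {suc M}         _         zero    = zero , P.refl
  clamp-onto {suc M} {suc n} (s≤s n<M) (suc i) with clamp-onto {M} {n} n<M i
  ... | u , clamp≡i = suc u , P.cong suc clamp≡i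

  some-partition : ∀ n → 1 ℕ.≤ n → n ℕ.≤ N → ∃ λ g → IsPartition n g
  some-partition (suc n) _ n≤N = clamp , clamp-onto n≤N

  optimal-family : ∀ n → 1 ℕ.≤ n → n ℕ.≤ N → ∃ λ f → IsFamily n f × ι G n ≡ value G n f
  optimal-family n 1≤n n≤N with some-partition n 1≤n n≤N
  ... | g , onto = ι-attained n (asFamily g) (partition⇒family n g onto)

  optimal-partition : ∀ n → 1 ℕ.≤ n → n ℕ.≤ N →
    ∃ λ g → IsPartition n g × ι~ G n ≡ value G n (asFamily g)
  optimal-partition n 1≤n n≤N with some-partition n 1≤n n≤N
  ... | g , onto = ι~-attained n g onto

module PartA {F : OrderedField} {N : ℕ} (G : MarkovGraph F N) where
  open OrderedField F
  open FieldFacts F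
  open Cuts G
  open Optima G

  -- Every partition is a family.
  ι≤ι~ : ∀ n → 1 ℕ.≤ n → n ℕ.≤ N → ι G n ≤ ι~ G n
  ι≤ι~ n 1≤n n≤N with optimal-partition n 1≤n n≤N
  ... | g , onto , ι~≡ = ≤-trans (ι-≤ n (asFamily g) (partition⇒family n g onto))
                                 (≤-reflexive (reflexive (P.sym ι~≡)))

  -- Relabelling that puts the uncovered vertices (label 0) into Q_1.
  absorb : ∀ {n} → Fin (suc (suc n)) → Fin (suc n)
  absorb zero    = zero
  absorb (suc i) = i

  absorb-block : ∀ {n} (f : Fin N → Fin (suc (suc n))) (l : Fin n) →
    block (asFamily (λ u → absorb (f u))) (suc (suc l)) ≗ block f (suc (suc l))
  absorb-block f l u with f u
  ... | zero  = P.refl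
  ... | suc i = P.refl

  -- Absorbing the uncovered vertices changes only the first ratio, by at most 1
  -- since ratios lie in [0,1].
  ι~≤ι+1/n : ∀ n → 1 ℕ.≤ n → n ℕ.≤ N → ι~ G n ≤ ι G n + fromℕ n ⁻¹
  ι~≤ι+1/n (suc n) 1≤n n≤N with optimal-family (suc n) 1≤n n≤N
  ... | f , fam , ι≡ = ≤-trans (ι~-≤ (suc n) g onto)
                               (≤-resp refl (+-congʳ (reflexive (P.sym ι≡))) value-bound)
    where
    g : Fin N → Fin (suc n)
    g u = absorb (f u)
    onto : IsPartition (suc n) g
    onto i with fam i
    ... | u , fu≡ = u , P.cong absorb fu≡
    ratio-of : (Fin N → Fin (suc (suc n))) → Fin (suc n) → Carrier
    ratio-of h i = ratio (block h (suc i))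
    first : ratio-of (asFamily g) zero ≤ 1# + ratio-of f zero
    first = ≤-trans (ratio≤1 _ (block-pos _ (suc zero) (partition⇒family (suc n) g onto zero)))
                    (≤-+ʳ (ratio-nonneg _ (block-pos f (suc zero) (fam zero))))
    others : sumF (λ l → ratio-of (asFamily g) (suc l)) ≈ sumF (λ l → ratio-of f (suc l))
    others = sumF-cong (λ l → sym (ratio-cong (block-pos f (suc (suc l)) (fam (suc l)))
                                               (λ u → P.sym (absorb-block f l u))))
    sum-bound : sumF (ratio-of (asFamily g)) ≤ sumF (ratio-of f) + 1#
    sum-bound = ≤-resp refl (solve 3 (λ a b c → (a :+ b) :+ c := (b :+ c) :+ a) refl _ _ _)
                        (+-mono-≤ first (≤-reflexive others))
    value-bound : value G (suc n) (asFamily g) ≤ value G (suc n) f + fromℕ (suc n) ⁻¹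
    value-bound = ≤-resp refl (trans (distribˡ _ _ _) (+-congˡ (*-identityʳ _)))
                         (*-monoˡ-≤ _ (⁻¹-nonneg (fromℕ-pos n)) sum-bound)

  partA : ∀ n → 1 ℕ.≤ n → n ℕ.≤ N → (0# ≤ ι~ G n - ι G n) × (ι~ G n - ι G n ≤ fromℕ n ⁻¹)
  partA n 1≤n n≤N = ≤⇒0≤- (ι≤ι~ n 1≤n n≤N)
                  , ≤-resp refl (solve 2 (λ a b → (a :+ b) :- a := b) refl (ι G n) (fromℕ n ⁻¹))
                           (+-monoˡ-≤ (- ι G n) (ι~≤ι+1/n n 1≤n n≤N))

-- Part (d): ι_n ≤ ι_{n+1}.  From an optimal family of n+1 sets, drop the set of
-- largest ratio r_k: the remaining sum R satisfies R ≤ n r_k, hence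
-- R/n ≤ (r_k + R)/(n+1).
module PartD {F : OrderedField} {N : ℕ} (G : MarkovGraph F N) where
  open OrderedField F
  open FieldFacts F
  open Cuts G
  open Optima G

  argmax : ∀ {m} (r : Fin (suc m) → Carrier) → ∃ λ k → ∀ i → r i ≤ r k
  argmax {zero}  r = zero , λ { zero → ≤-refl }
  argmax {suc m} r with argmax (λ i → r (suc i))
  ... | k , r≤rk with O.total (r zero) (r (suc k))
  ...   | inj₁ r0≤ = suc k , λ { zero → r0≤ ; (suc i) → r≤rk i }
  ...   | inj₂ ≤r0 = zero  , λ { zero → ≤-refl ; (suc i) → ≤-trans (r≤rk i) ≤r0 }

  -- Relabelling that uncovers the set with label suc k and renumbers the others.
  discard : ∀ {n} (k : Fin (suc n)) → Fin (suc (suc n)) → Fin (suc n)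
  discard k x with suc k Fin.≟ x
  ... | yes _   = zero
  ... | no  k≢x = punchOut k≢x

  discard-block : ∀ {n} (k : Fin (suc n)) x (l : Fin n) →
    does (discard k x Fin.≟ suc l) ≡ does (x Fin.≟ suc (punchIn k l))
  discard-block k x l with suc k Fin.≟ x
  ... | yes k≡x = does-⇔ zero (suc l) x (suc (punchIn k l)) (λ ())
        (λ x≡ → ⊥-elim (FinP.punchInᵢ≢i (suc k) (suc l) (P.trans (P.sym x≡) (P.sym k≡x))))
  ... | no  k≢x = does-⇔ (punchOut k≢x) (suc l) x (suc (punchIn k l))
        (punchOut≡⇒ k≢x (suc l)) (≡punchIn⇒ k≢x (suc l))

  discard-hit : ∀ {n} (k : Fin (suc n)) x (l : Fin n) → x ≡ suc (punchIn k l) → discard k x ≡ suc l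
  discard-hit k x l x≡ with suc k Fin.≟ x
  ... | yes k≡x = ⊥-elim (FinP.punchInᵢ≢i (suc k) (suc l) (P.trans (P.sym x≡) (P.sym k≡x)))
  ... | no  k≢x = ≡punchIn⇒ k≢x (suc l) x≡

  average-drop-max : ∀ n rₖ R → R ≤ fromℕ (suc n) * rₖ →
    R * fromℕ (suc n) ⁻¹ ≤ (rₖ + R) * fromℕ (suc (suc n)) ⁻¹
  average-drop-max n rₖ R R≤nrₖ = cross-≤ (fromℕ-pos n) (fromℕ-pos (suc n))
    (≤-resp (solve 3 (λ R a b → R :* a :+ b :* R := R :* (b :+ a)) refl R (fromℕ (suc n)) 1#)
            (solve 3 (λ R a r → R :* a :+ a :* r := (r :+ R) :* a) refl R (fromℕ (suc n)) rₖ)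
            (+-monoʳ-≤ (R * fromℕ (suc n)) (≤-resp (sym (*-identityˡ R)) refl R≤nrₖ)))

  ι-mono : ∀ n → 1 ℕ.≤ n → suc n ℕ.≤ N → ι G n ≤ ι G (suc n)
  ι-mono (suc n) _ n+1≤N with optimal-family (suc (suc n)) (s≤s z≤n) n+1≤N
  ... | f , fam , ι≡ with argmax (λ i → ratio (block f (suc i)))
  ...   | k , r≤rk = ≤-trans (ι-≤ (suc n) f' fam') (≤-resp refl (reflexive (P.sym ι≡)) value-bound)
    where
    r : Fin (suc (suc n)) → Carrier
    r i = ratio (block f (suc i))
    f' : Fin N → Fin (suc (suc n))
    f' u = discard k (f u)
    fam' : IsFamily (suc n) f'
    fam' l with fam (punchIn k l)
    ... | u , fu≡ = u , discard-hit k (f u) l fu≡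
    R : Carrier
    R = sumF (λ l → r (punchIn k l))
    kept : sumF (λ l → ratio (block f' (suc l))) ≈ R
    kept = sumF-cong (λ l → ratio-cong (block-pos f' (suc l) (fam' l)) (λ u → discard-block k (f u) l))
    value-bound : value G (suc n) f' ≤ value G (suc (suc n)) f
    value-bound = ≤-resp (trans (*-comm _ _) (*-congˡ (sym kept)))
                         (trans (*-congʳ (sym (sumF-extract k r))) (*-comm _ _))
                         (average-drop-max n (r k) R (sumF-bound (r k) (λ l → r≤rk (punchIn k l))))

-- Part (b): ι~_2 = ι_2.  For disjoint Q_1, Q_2 with ∂Q_1 ≤ ∂Q_2 (say), the
-- partition {Q_1, V∖Q_1} is no worse, since ∂(V∖Q_1) = ∂Q_1 ≤ ∂Q_2 and
-- π(V∖Q_1) ≥ π(Q_2).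
module PartB {F : OrderedField} {N : ℕ} (G : MarkovGraph F N) where
  open OrderedField F
  open FieldFacts F
  open Cuts G
  open Optima G
  open PartA G using (ι≤ι~)

  ratio-∁-≤ : ∀ T U → (∀ u → U u ≡ true → ∁ T u ≡ true) → boundary T ≤ boundary U →
    0# < mass (∁ T) → 0# < mass U → ratio (∁ T) ≤ ratio U
  ratio-∁-≤ T U U⊆∁T ∂T≤∂U 0<π∁T 0<πU = ≤-resp (*-congʳ (boundary-∁ T)) refl
    (cross-≤ 0<π∁T 0<πU (≤-trans (*-monoʳ-≤ _ (mass-nonneg U) ∂T≤∂U)
                                  (*-monoˡ-≤ _ (boundary-nonneg U) (mass-mono U (∁ T) U⊆∁T))))

  bipartition : Subset → Fin N → Fin 2
  bipartition S u = if S u then zero else suc zero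

  bipartition-first : ∀ S → block (asFamily (bipartition S)) (suc zero) ≗ S
  bipartition-first S u with S u
  ... | true  = P.refl
  ... | false = P.refl

  bipartition-second : ∀ S → block (asFamily (bipartition S)) (suc (suc zero)) ≗ ∁ S
  bipartition-second S u with S u
  ... | true  = P.refl
  ... | false = P.refl

  half : Carrier → Carrier → Carrier
  half x y = fromℕ 2 ⁻¹ * (x + (y + 0#))

  half-mono : ∀ {x x' y y'} → x ≤ x' → y ≤ y' → half x y ≤ half x' y'
  half-mono x≤x' y≤y' = *-monoˡ-≤ _ (⁻¹-nonneg (fromℕ-pos 1)) (+-mono-≤ x≤x' (+-monoˡ-≤ 0# y≤y'))

  ι~₂-≤ : ∀ S → (∃ λ u → S u ≡ true) → (∃ λ u → S u ≡ false) →
    ι~ G 2 ≤ half (ratio S) (ratio (∁ S))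
  ι~₂-≤ S (u , Su) (w , ¬Sw) = ≤-trans (ι~-≤ 2 g onto)
    (≤-reflexive (*-congˡ (+-cong (ratio-cong (pos zero) (bipartition-first S))
                                  (+-congʳ (ratio-cong (pos (suc zero)) (bipartition-second S))))))
    where
    g : Fin N → Fin 2
    g = bipartition S
    onto : IsPartition 2 g
    onto zero       = u , P.cong (λ b → if b then zero else suc zero) Su
    onto (suc zero) = w , P.cong (λ b → if b then zero else suc zero) ¬Sw
    pos : ∀ i → 0# < mass (block (asFamily g) (suc i))
    pos i = block-pos (asFamily g) (suc i) (partition⇒family 2 g onto i)

  ι~₂≤ι₂ : 2 ℕ.≤ N → ι~ G 2 ≤ ι G 2
  ι~₂≤ι₂ 2≤N with optimal-family 2 (s≤s z≤n) 2≤N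
  ... | f , fam , ι≡ = ≤-resp refl (reflexive (P.sym ι≡)) better
    where
    Q₁ Q₂ : Subset
    Q₁ = block f (suc zero)
    Q₂ = block f (suc (suc zero))
    u₁ u₂ : Fin N
    u₁ = proj₁ (fam zero)
    u₂ = proj₁ (fam (suc zero))
    labelled : ∀ {u x} j → f u ≡ x → block f j u ≡ does (x Fin.≟ j)
    labelled j fu≡x = P.cong (λ y → does (y Fin.≟ j)) fu≡x
    in₁ : Q₁ u₁ ≡ true
    in₁ = labelled (suc zero) (proj₂ (fam zero))
    in₂ : Q₂ u₂ ≡ true
    in₂ = labelled (suc (suc zero)) (proj₂ (fam (suc zero)))
    out₁ : Q₁ u₂ ≡ false
    out₁ = labelled (suc zero) (proj₂ (fam (suc zero)))
    out₂ : Q₂ u₁ ≡ false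
    out₂ = labelled (suc (suc zero)) (proj₂ (fam zero))
    Q₂⊆∁Q₁ : ∀ u → Q₂ u ≡ true → ∁ Q₁ u ≡ true
    Q₂⊆∁Q₁ u with f u
    ... | zero           = λ ()
    ... | suc zero       = λ ()
    ... | suc (suc zero) = λ _ → P.refl
    Q₁⊆∁Q₂ : ∀ u → Q₁ u ≡ true → ∁ Q₂ u ≡ true
    Q₁⊆∁Q₂ u with f u
    ... | zero           = λ ()
    ... | suc zero       = λ _ → P.refl
    ... | suc (suc zero) = λ ()
    0<πQ₁ : 0# < mass Q₁
    0<πQ₁ = mass-pos Q₁ u₁ in₁
    0<πQ₂ : 0# < mass Q₂
    0<πQ₂ = mass-pos Q₂ u₂ in₂
    ∁∁Q₂ : ∁ (∁ Q₂) ≗ Q₂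
    ∁∁Q₂ u with Q₂ u
    ... | true  = P.refl
    ... | false = P.refl
    better : ι~ G 2 ≤ value G 2 f
    better with O.total (boundary Q₁) (boundary Q₂)
    ... | inj₁ ∂Q₁≤∂Q₂ = ≤-trans (ι~₂-≤ Q₁ (u₁ , in₁) (u₂ , out₁)) (half-mono ≤-refl
            (ratio-∁-≤ Q₁ Q₂ Q₂⊆∁Q₁ ∂Q₁≤∂Q₂ (mass-pos (∁ Q₁) u₂ (P.cong not out₁)) 0<πQ₂))
    ... | inj₂ ∂Q₂≤∂Q₁ = ≤-trans (ι~₂-≤ (∁ Q₂) (u₁ , P.cong not out₂) (u₂ , P.cong not in₂))
          (half-mono (ratio-∁-≤ Q₂ Q₁ Q₁⊆∁Q₂ ∂Q₂≤∂Q₁ (mass-pos (∁ Q₂) u₁ (P.cong not out₂)) 0<πQ₁)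
                     (≤-reflexive (sym (ratio-cong 0<πQ₂ (λ u → P.sym (∁∁Q₂ u))))))

  partB : 2 ℕ.≤ N → ι~ G 2 ≈ ι G 2
  partB 2≤N = ≤-antisym (ι~₂≤ι₂ 2≤N) (ι≤ι~ 2 (s≤s z≤n) 2≤N)

-- For m = n+1
-- blocks with masses p_i (Σ p_i = 1), ratios r_i and flows c_ij satisfying
-- Σ_{j≠i} c_ij = r_i p_i, put S = Σ r_i, X_ij = r_i p_j + r_j p_i + c_ij + c_ji and
--   T_ij = n X_ij - S (p_i + p_j).
-- Then Σ_{i≠j} T_ij = 2nS - 2nS = 0, so some pair i ≠ j has T_ij ≥ 0.
module PairAveraging (F : OrderedField) where
  open OrderedField F
  open FieldFacts F
  open import Relation.Binary.Reasoning.Setoid setoid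

  offDiag : ∀ {m} → Fin m → Fin m → Carrier → Carrier
  offDiag i j x = if does (i Fin.≟ j) then 0# else x

  offDiag-+ : ∀ {m} (i j : Fin m) x y → offDiag i j (x + y) ≈ offDiag i j x + offDiag i j y
  offDiag-+ i j x y with does (i Fin.≟ j)
  ... | true  = sym (+-identityˡ 0#)
  ... | false = refl

  offDiag-- : ∀ {m} (i j : Fin m) x y → offDiag i j (x - y) ≈ offDiag i j x - offDiag i j y
  offDiag-- i j x y with does (i Fin.≟ j)
  ... | true  = sym (-‿inverseʳ 0#)
  ... | false = refl

  offDiag-*ˡ : ∀ {m} (i j : Fin m) c x → offDiag i j (c * x) ≈ c * offDiag i j x
  offDiag-*ˡ i j c x with does (i Fin.≟ j)
  ... | true  = sym (zeroʳ c)
  ... | false = refl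

  offDiag-*ʳ : ∀ {m} (i j : Fin m) c x → offDiag i j (x * c) ≈ offDiag i j x * c
  offDiag-*ʳ i j c x with does (i Fin.≟ j)
  ... | true  = sym (zeroˡ c)
  ... | false = refl

  offDiag-sym : ∀ {m} (i j : Fin m) x → offDiag i j x ≡ offDiag j i x
  offDiag-sym i j x = P.cong (λ b → if b then 0# else x) (does-sym i j)

  sumF-offDiag : ∀ {m} (i : Fin m) (y : Fin m → Carrier) → sumF (λ j → offDiag i j (y j)) ≈ sumF y - y i
  sumF-offDiag i y = begin
    sumF (λ j → offDiag i j (y j))
      ≈⟨ solve 2 (λ a b → b := (a :+ b) :- a) refl (y i) _ ⟩
    (y i + sumF (λ j → offDiag i j (y j))) - y i
      ≈⟨ +-congʳ (+-congʳ (sym (sumF-pick i y))) ⟩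
    (sumF diag + sumF (λ j → offDiag i j (y j))) - y i
      ≈⟨ +-congʳ (sym (sumF-+ diag (λ j → offDiag i j (y j)))) ⟩
    sumF (λ j → diag j + offDiag i j (y j)) - y i
      ≈⟨ +-congʳ (sumF-cong recombine) ⟩
    sumF y - y i ∎
    where
    diag : _ → Carrier
    diag j = if does (i Fin.≟ j) then y j else 0#
    recombine : ∀ j → diag j + offDiag i j (y j) ≈ y j
    recombine j with does (i Fin.≟ j)
    ... | true  = +-identityʳ _
    ... | false = +-identityˡ _

  offSum : ∀ {m} → (Fin m → Fin m → Carrier) → Carrier
  offSum f = sumF (λ i → sumF (λ j → offDiag i j (f i j)))

  offSum-+ : ∀ {m} (f g : Fin m → Fin m → Carrier) → offSum (λ i j → f i j + g i j) ≈ offSum f + offSum g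
  offSum-+ f g = trans (sumF-cong (λ i → trans (sumF-cong (λ j → offDiag-+ i j (f i j) (g i j)))
                                                (sumF-+ (λ j → offDiag i j (f i j)) (λ j → offDiag i j (g i j)))))
                       (sumF-+ (λ i → sumF (λ j → offDiag i j (f i j))) (λ i → sumF (λ j → offDiag i j (g i j))))

  offSum-- : ∀ {m} (f g : Fin m → Fin m → Carrier) → offSum (λ i j → f i j - g i j) ≈ offSum f - offSum g
  offSum-- f g = trans (sumF-cong (λ i → trans (sumF-cong (λ j → offDiag-- i j (f i j) (g i j)))
                                                (sumF-- (λ j → offDiag i j (f i j)) (λ j → offDiag i j (g i j)))))
                       (sumF-- (λ i → sumF (λ j → offDiag i j (f i j))) (λ i → sumF (λ j → offDiag i j (g i j))))

  offSum-*ˡ : ∀ {m} c (f : Fin m → Fin m → Carrier) → offSum (λ i j → c * f i j) ≈ c * offSum f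
  offSum-*ˡ c f = trans (sumF-cong (λ i → trans (sumF-cong (λ j → offDiag-*ˡ i j c (f i j)))
                                                 (sumF-*ˡ c (λ j → offDiag i j (f i j)))))
                        (sumF-*ˡ c (λ i → sumF (λ j → offDiag i j (f i j))))

  offSum-nonneg-entry : ∀ {m} (T : Fin (suc (suc m)) → Fin (suc (suc m)) → Carrier) →
    offSum T ≈ 0# → ∃₂ λ i j → i ≢ j × 0# ≤ T i j
  offSum-nonneg-entry T ΣT≈0
    with any? (λ i → any? (λ j → ¬? (i Fin.≟ j) ×-dec (0# ≤? T i j)))
  ... | yes (i , j , i≢j , 0≤T) = i , j , i≢j , 0≤T
  ... | no  none = ⊥-elim (none (zero , suc zero , (λ ()) , 0≤T₀₁))
    where
    nonpos : ∀ i j → offDiag i j (T i j) ≤ 0#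
    nonpos i j with i Fin.≟ j | O.total (T i j) 0#
    ... | yes _   | _        = ≤-refl
    ... | no  _   | inj₁ T≤0 = T≤0
    ... | no  i≢j | inj₂ 0≤T = ⊥-elim (none (i , j , i≢j , 0≤T))
    0≤T₀₁ : 0# ≤ T zero (suc zero)
    0≤T₀₁ = ≤-trans (≤-reflexive (sym ΣT≈0))
              (≤-trans (sumF-≤-term (λ i → sumF-nonpos (nonpos i)) zero)
                       (sumF-≤-term (nonpos zero) (suc zero)))

  module Identity {n : ℕ} (r p : Fin (suc n) → Carrier) (c : Fin (suc n) → Fin (suc n) → Carrier)
                  (Σp≈1 : sumF p ≈ 1#) (Σc≈rp : ∀ i → sumF (λ j → offDiag i j (c i j)) ≈ r i * p i) where

    S W : Carrier
    S = sumF r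
    W = sumF (λ i → r i * p i)

    X T : Fin (suc n) → Fin (suc n) → Carrier
    X i j = r i * p j + r j * p i + c i j + c j i
    T i j = fromℕ n * X i j - S * (p i + p j)

    Σrp : offSum (λ i j → r i * p j) ≈ S - W
    Σrp = begin
      offSum (λ i j → r i * p j)
        ≈⟨ sumF-cong {suc n} (λ i → trans (sumF-cong (λ j → offDiag-*ˡ i j (r i) (p j)))
            (sumF-*ˡ (r i) (λ j → offDiag i j (p j)))) ⟩
      sumF (λ i → r i * sumF (λ j → offDiag i j (p j)))
        ≈⟨ sumF-cong (λ i → *-congˡ {r i} (trans (sumF-offDiag i p) (+-congʳ Σp≈1))) ⟩
      sumF (λ i → r i * (1# - p i))
        ≈⟨ sumF-cong (λ i → trans (solve 3 (λ r p o → r :* (o :- p) := r :* o :- r :* p) refl (r i) (p i) 1#)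
            (+-congʳ (*-identityʳ _))) ⟩
      sumF (λ i → r i - r i * p i)
        ≈⟨ sumF-- r (λ i → r i * p i) ⟩
      S - W ∎

    Σrp′ : offSum (λ i j → r j * p i) ≈ S - W
    Σrp′ = begin
      offSum (λ i j → r j * p i)
        ≈⟨ sumF-cong (λ i → trans (sumF-cong (λ j → offDiag-*ʳ i j (p i) (r j)))
            (trans (sumF-*ʳ (p i) (λ j → offDiag i j (r j)))
            (*-congʳ (sumF-offDiag i r)))) ⟩
      sumF (λ i → (S - r i) * p i)
        ≈⟨ sumF-cong (λ i → solve 3 (λ s r p → (s :- r) :* p := s :* p :- r :* p) refl S (r i) (p i)) ⟩
      sumF (λ i → S * p i - r i * p i)
        ≈⟨ sumF-- (λ i → S * p i) (λ i → r i * p i) ⟩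
      sumF (λ i → S * p i) - W
        ≈⟨ +-congʳ (trans (sumF-*ˡ S p) (trans (*-congˡ Σp≈1) (*-identityʳ _))) ⟩
      S - W ∎

    Σc : offSum c ≈ W
    Σc = sumF-cong Σc≈rp

    Σc′ : offSum (λ i j → c j i) ≈ W
    Σc′ = begin
      offSum (λ i j → c j i)
        ≈⟨ sumF-swap (λ i j → offDiag i j (c j i)) ⟩
      sumF (λ j → sumF (λ i → offDiag i j (c j i)))
        ≈⟨ sumF-cong (λ j → sumF-cong (λ i → reflexive (offDiag-sym i j (c j i)))) ⟩
      offSum c
        ≈⟨ Σc ⟩
      W ∎

    Σp : offSum (λ i j → p i) ≈ fromℕ n
    Σp = begin
      offSum (λ i j → p i)
        ≈⟨ sumF-cong (λ i → trans (sumF-offDiag i (λ _ → p i)) (+-congʳ (sumF-const {suc n} (p i)))) ⟩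
      sumF (λ i → fromℕ (suc n) * p i - p i)
        ≈⟨ sumF-- (λ i → fromℕ (suc n) * p i) p ⟩
      sumF (λ i → fromℕ (suc n) * p i) - sumF p
        ≈⟨ +-cong (trans (sumF-*ˡ _ p) (trans (*-congˡ Σp≈1) (*-identityʳ _))) (-‿cong Σp≈1) ⟩
      (1# + fromℕ n) - 1#
        ≈⟨ solve 2 (λ o n → (o :+ n) :- o := n) refl 1# (fromℕ n) ⟩
      fromℕ n ∎

    Σp′ : offSum (λ i j → p j) ≈ fromℕ n
    Σp′ = begin
      offSum (λ i j → p j)
        ≈⟨ sumF-cong (λ i → trans (sumF-offDiag i p) (+-congʳ Σp≈1)) ⟩
      sumF (λ i → 1# - p i)
        ≈⟨ sumF-- (λ _ → 1#) p ⟩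
      sumF {suc n} (λ _ → 1#) - sumF p
        ≈⟨ +-cong (trans (sumF-const {suc n} 1#) (*-identityʳ _)) (-‿cong Σp≈1) ⟩
      (1# + fromℕ n) - 1#
        ≈⟨ solve 2 (λ o n → (o :+ n) :- o := n) refl 1# (fromℕ n) ⟩
      fromℕ n ∎

    ΣX : offSum X ≈ S + S
    ΣX = begin
      offSum X
        ≈⟨ offSum-+ rpc (λ i j → c j i) ⟩
      offSum rpc + offSum (λ i j → c j i)
        ≈⟨ +-congʳ (offSum-+ rp c) ⟩
      offSum rp + offSum c + offSum (λ i j → c j i)
        ≈⟨ +-congʳ (+-congʳ (offSum-+ (λ i j → r i * p j) (λ i j → r j * p i))) ⟩
      offSum (λ i j → r i * p j) + offSum (λ i j → r j * p i) + offSum c + offSum (λ i j → c j i)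
        ≈⟨ +-cong (+-cong (+-cong Σrp Σrp′) Σc) Σc′ ⟩
      (S - W) + (S - W) + W + W
        ≈⟨ solve 2 (λ s w → (s :- w) :+ (s :- w) :+ w :+ w := s :+ s) refl S W ⟩
      S + S ∎
      where
      rp rpc : Fin (suc n) → Fin (suc n) → Carrier
      rp  i j = r i * p j + r j * p i
      rpc i j = rp i j + c i j

    ΣT≈0 : offSum T ≈ 0#
    ΣT≈0 = begin
      offSum T
        ≈⟨ offSum-- (λ i j → fromℕ n * X i j) (λ i j → S * pp i j) ⟩
      offSum (λ i j → fromℕ n * X i j) - offSum (λ i j → S * pp i j)
        ≈⟨ +-cong (offSum-*ˡ (fromℕ n) X) (-‿cong (offSum-*ˡ S pp)) ⟩
      fromℕ n * offSum X - S * offSum pp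
        ≈⟨ +-cong (*-congˡ ΣX) (-‿cong (*-congˡ Σpp)) ⟩
      fromℕ n * (S + S) - S * (fromℕ n + fromℕ n)
        ≈⟨ solve 2 (λ n s → n :* (s :+ s) :- s :* (n :+ n) := con (+ 0)) refl (fromℕ n) S ⟩
      0# ∎
      where
      pp : Fin (suc n) → Fin (suc n) → Carrier
      pp i j = p i + p j
      Σpp : offSum pp ≈ fromℕ n + fromℕ n
      Σpp = trans (offSum-+ (λ i j → p i) (λ i j → p j)) (+-cong Σp Σp′)

module Blocks {F : OrderedField} {N : ℕ} (G : MarkovGraph F N) where
  open OrderedField F
  open MarkovGraph G
  open FieldFacts F
  open Cuts G
  open PairAveraging F using (offDiag)
  open import Relation.Binary.Reasoning.Setoid setoid

  _∪_ : Subset → Subset → Subset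
  (S ∪ T) u = S u ∨ T u

  Disjoint : Subset → Subset → Set
  Disjoint S T = ∀ u → S u ≡ true → T u ≡ true → ⊥

  mass-∪ : ∀ S T → Disjoint S T → mass (S ∪ T) ≈ mass S + mass T
  mass-∪ S T S∩T=∅ = trans (sumF-cong (λ u → pointwise (S u) (T u) (π u) (S∩T=∅ u)))
    (sumF-+ (λ u → if S u then π u else 0#) (λ u → if T u then π u else 0#))
    where
    pointwise : ∀ a b x → (a ≡ true → b ≡ true → ⊥) →
      (if a ∨ b then x else 0#) ≈ (if a then x else 0#) + (if b then x else 0#)
    pointwise true  true  x a∩b=∅ = ⊥-elim (a∩b=∅ P.refl P.refl)
    pointwise true  false x _ = sym (+-identityʳ x)
    pointwise false true  x _ = sym (+-identityˡ x)
    pointwise false false x _ = sym (+-identityˡ 0#)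

  leaves enters : Bool → Bool → Carrier → Carrier
  leaves a c x = if a then (if c then 0# else x) else 0#
  enters a e x = if a then (if e then x else 0#) else 0#

  -- Boundary of a disjoint union: the flows between the two parts are internal.
  boundary-∪ : ∀ S T → Disjoint S T →
    boundary (S ∪ T) ≈ ((boundary S + boundary T) - flow S T) - flow T S
  boundary-∪ S T S∩T=∅ = trans
    (sumF-cong (λ u → trans
      (sumF-cong (λ v → pointwise (S u) (T u) (S v) (T v) (φ G u v) (S∩T=∅ u) (S∩T=∅ v)))
      (sum4 (λ v → leaves (S u) (S v) (φ G u v)) (λ v → leaves (T u) (T v) (φ G u v))
            (λ v → enters (S u) (T v) (φ G u v)) (λ v → enters (T u) (S v) (φ G u v)))))
    (sum4 (λ u → sumF (λ v → leaves (S u) (S v) (φ G u v))) (λ u → sumF (λ v → leaves (T u) (T v) (φ G u v)))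
          (λ u → sumF (λ v → enters (S u) (T v) (φ G u v))) (λ u → sumF (λ v → enters (T u) (S v) (φ G u v))))
    where
    sum4 : ∀ {k} (a b c e : Fin k → Carrier) →
      sumF (λ u → ((a u + b u) - c u) - e u) ≈ ((sumF a + sumF b) - sumF c) - sumF e
    sum4 a b c e = trans (sumF-- (λ u → (a u + b u) - c u) e)
                         (+-congʳ (trans (sumF-- (λ u → a u + b u) c) (+-congʳ (sumF-+ a b))))
    o : ∀ {k} → Polynomial k
    o = con (+ 0)
    pointwise : ∀ a b c e x → (a ≡ true → b ≡ true → ⊥) → (c ≡ true → e ≡ true → ⊥) →
      (if a ∨ b then (if c ∨ e then 0# else x) else 0#)
        ≈ ((leaves a c x + leaves b e x) - enters a e x) - enters b c x
    pointwise true  true  c     e     x a∩b=∅ _ = ⊥-elim (a∩b=∅ P.refl P.refl)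
    pointwise a     b     true  true  x _ c∩e=∅ = ⊥-elim (c∩e=∅ P.refl P.refl)
    pointwise true  false true  false x _ _ = solve 0 (o := ((o :+ o) :- o) :- o) refl
    pointwise true  false false true  x _ _ = solve 1 (λ x → o := ((x :+ o) :- x) :- o) refl x
    pointwise true  false false false x _ _ = solve 1 (λ x → x := ((x :+ o) :- o) :- o) refl x
    pointwise false true  true  false x _ _ = solve 1 (λ x → o := ((o :+ x) :- o) :- x) refl x
    pointwise false true  false true  x _ _ = solve 0 (o := ((o :+ o) :- o) :- o) refl
    pointwise false true  false false x _ _ = solve 1 (λ x → x := ((o :+ x) :- o) :- o) refl x
    pointwise false false c     e     x _ _ = solve 0 (o := ((o :+ o) :- o) :- o) refl


  block⇒≡ : ∀ {m} (g : Fin N → Fin m) i u → block g i u ≡ true → g u ≡ i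
  block⇒≡ g i u u∈ with g u Fin.≟ i
  ... | yes gu≡i = gu≡i
  ... | no  _ with u∈
  ...   | ()

  blocks-disjoint : ∀ {m} (g : Fin N → Fin m) {i j} → i ≢ j → Disjoint (block g i) (block g j)
  blocks-disjoint g {i} {j} i≢j u u∈i u∈j = i≢j (P.trans (P.sym (block⇒≡ g i u u∈i)) (block⇒≡ g j u u∈j))

  blocks-mass : ∀ {m} (g : Fin N → Fin m) → sumF (λ i → mass (block g i)) ≈ 1#
  blocks-mass g = begin
    sumF (λ i → mass (block g i))
      ≈⟨ sumF-swap (λ i u → if does (g u Fin.≟ i) then π u else 0#) ⟩
    sumF (λ u → sumF (λ i → if does (g u Fin.≟ i) then π u else 0#))
      ≈⟨ sumF-cong (λ u → sumF-pick (g u) (λ _ → π u)) ⟩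
    sumF π
      ≈⟨ π-sum ⟩
    1# ∎

  boundary-as-flows : ∀ {m} (g : Fin N → Fin m) i →
    sumF (λ j → offDiag i j (flow (block g i) (block g j))) ≈ boundary (block g i)
  boundary-as-flows {m} g i = begin
    sumF (λ j → offDiag i j (flow (A i) (A j)))
      ≈⟨ sumF-cong (λ j → trans (offDiag-sumF j (λ u → sumF (λ v → term j u v)))
          (sumF-cong (λ u → trans (offDiag-sumF j (term j u)) (sumF-cong (λ v → offDiag-term j u v))))) ⟩
    sumF (λ j → sumF (λ u → sumF (λ v → term′ j u v)))
      ≈⟨ sumF-swap (λ j u → sumF (λ v → term′ j u v)) ⟩
    sumF (λ u → sumF (λ j → sumF (λ v → term′ j u v)))
      ≈⟨ sumF-cong (λ u → sumF-swap (λ j v → term′ j u v)) ⟩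
    sumF (λ u → sumF (λ v → sumF (λ j → term′ j u v)))
      ≈⟨ sumF-cong (λ u → sumF-cong (λ v →
          sym (if-sumF (A i u) (λ j → if A j v then offDiag i j (φ G u v) else 0#)))) ⟩
    sumF (λ u → sumF (λ v → if A i u then sumF (λ j → if A j v then offDiag i j (φ G u v) else 0#) else 0#))
      ≈⟨ sumF-cong (λ u → sumF-cong (λ v →
          if-cong (A i u) (sumF-pick (g v) (λ j → offDiag i j (φ G u v))))) ⟩
    sumF (λ u → sumF (λ v → if A i u then offDiag i (g v) (φ G u v) else 0#))
      ≈⟨ sumF-cong (λ u → sumF-cong (λ v → if-cong (A i u)
          (reflexive (P.cong (λ b → if b then 0# else φ G u v) (does-sym i (g v)))))) ⟩
    boundary (A i) ∎
    where
    A : Fin m → Subset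
    A = block g
    term term′ : Fin m → Fin N → Fin N → Carrier
    term  j u v = if A i u then (if A j v then φ G u v else 0#) else 0#
    term′ j u v = if A i u then (if A j v then offDiag i j (φ G u v) else 0#) else 0#
    offDiag-sumF : ∀ {k} j (f : Fin k → Carrier) → offDiag i j (sumF f) ≈ sumF (λ u → offDiag i j (f u))
    offDiag-sumF {k} j f with does (i Fin.≟ j)
    ... | true  = sym (sumF-0 {k})
    ... | false = refl
    offDiag-term : ∀ j u v → offDiag i j (term j u v) ≈ term′ j u v
    offDiag-term j u v with does (i Fin.≟ j) | A i u | A j v
    ... | true  | true  | true  = refl
    ... | true  | true  | false = refl
    ... | true  | false | _     = refl
    ... | false | true  | true  = refl
    ... | false | true  | false = refl
    ... | false | false | _     = refl

-- Merging the labels i ≠ j of Fin (2+n) into one label k₀ of Fin (1+n);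
-- the remaining labels are punchIn j (punchIn k₀ l).
module MergeLabels {n : ℕ} {i j : Fin (suc (suc n))} (i≢j : i ≢ j) where
  j≢i : j ≢ i
  j≢i j≡i = i≢j (P.sym j≡i)

  k₀ : Fin (suc n)
  k₀ = punchOut j≢i

  mergeLabel : Fin (suc (suc n)) → Fin (suc n)
  mergeLabel x with j Fin.≟ x
  ... | yes _   = k₀
  ... | no  j≢x = punchOut j≢x

  mergeLabel-hit : ∀ k x → x ≡ punchIn j k → mergeLabel x ≡ k
  mergeLabel-hit k x x≡ with j Fin.≟ x
  ... | yes j≡x = ⊥-elim (FinP.punchInᵢ≢i j k (P.trans (P.sym x≡) (P.sym j≡x)))
  ... | no  j≢x = ≡punchIn⇒ j≢x k x≡

  mergeLabel-merged : ∀ x → does (mergeLabel x Fin.≟ k₀) ≡ (does (x Fin.≟ i) ∨ does (x Fin.≟ j))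
  mergeLabel-merged x with j Fin.≟ x
  ... | yes P.refl rewrite dec-true (k₀ Fin.≟ k₀) P.refl | dec-true (j Fin.≟ j) P.refl
                         | ∨-zeroʳ (does (j Fin.≟ i)) = P.refl
  ... | no  j≢x rewrite dec-false (x Fin.≟ j) (λ x≡j → j≢x (P.sym x≡j)) | ∨-identityʳ (does (x Fin.≟ i)) =
    does-⇔ (punchOut j≢x) k₀ x i
      (λ out≡ → P.trans (punchOut≡⇒ j≢x k₀ out≡) (FinP.punchIn-punchOut j≢i))
      (λ x≡i → ≡punchIn⇒ j≢x k₀ (P.trans x≡i (P.sym (FinP.punchIn-punchOut j≢i))))

  mergeLabel-kept : ∀ x (l : Fin n) →
    does (mergeLabel x Fin.≟ punchIn k₀ l) ≡ does (x Fin.≟ punchIn j (punchIn k₀ l))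
  mergeLabel-kept x l with j Fin.≟ x
  ... | yes P.refl
    rewrite dec-false (k₀ Fin.≟ punchIn k₀ l) (λ k₀≡ → FinP.punchInᵢ≢i k₀ l (P.sym k₀≡))
          | dec-false (j Fin.≟ punchIn j (punchIn k₀ l)) (λ j≡ → FinP.punchInᵢ≢i j (punchIn k₀ l) (P.sym j≡))
    = P.refl
  ... | no  j≢x =
    does-⇔ (punchOut j≢x) (punchIn k₀ l) x (punchIn j (punchIn k₀ l)) (punchOut≡⇒ j≢x _) (≡punchIn⇒ j≢x _)

-- Take an optimal partition into n+1
-- blocks with ratio sum S; PairAveraging gives blocks i ≠ j with
-- n X_ij ≥ S (p_i + p_j), and their union B has
--   ratio B = r_i + r_j - X_ij/(p_i + p_j) ≤ r_i + r_j - S/n.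
-- The merged partition has ratio sum ≤ S - S/n, and (S - S/n)/n = (1 - 1/n²) S/(n+1).
module PartC {F : OrderedField} {N : ℕ} (G : MarkovGraph F N) where
  open OrderedField F
  open FieldFacts F
  open Cuts G
  open Optima G
  open Blocks G
  open PairAveraging F
  open import Relation.Binary.Reasoning.Setoid setoid

  shrink-identity : ∀ n S → 0# < n → n ⁻¹ * (S - S * n ⁻¹) ≈ (1# - (n * n) ⁻¹) * ((1# + n) ⁻¹ * S)
  shrink-identity n S 0<n = begin
    a * (S - S * a)
      ≈⟨ sym (*-identityʳ _) ⟩
    a * (S - S * a) * 1#
      ≈⟨ *-congˡ (sym (⁻¹-inverseʳ⁺ 0<1+n)) ⟩
    a * (S - S * a) * ((1# + n) * b)
      ≈⟨ solve 5 (λ a S n b o → a :* (S :- S :* a) :* ((o :+ n) :* b)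
          := (((a :* o :+ a :* n) :- a :* a :* o) :- a :* (a :* n)) :* (b :* S))
          refl a S n b 1# ⟩
    (((a * 1# + a * n) - a * a * 1#) - a * (a * n)) * (b * S)
      ≈⟨ *-congʳ (+-cong (+-cong (+-cong (*-identityʳ a) (⁻¹-inverseˡ⁺ 0<n)) (-‿cong (*-identityʳ _)))
          (-‿cong (⁻¹-*-cancel′))) ⟩
    (((a + 1#) - a * a) - a) * (b * S)
      ≈⟨ *-congʳ (solve 2 (λ a o → ((a :+ o) :- a :* a) :- a := o :- a :* a) refl a 1#) ⟩
    (1# - a * a) * (b * S)
      ≈⟨ *-congʳ (+-congˡ (-‿cong (sym (⁻¹-unique (*-pos 0<n 0<n) nn·aa≈1)))) ⟩
    (1# - (n * n) ⁻¹) * (b * S) ∎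
    where
    a b : Carrier
    a = n ⁻¹
    b = (1# + n) ⁻¹
    0<1+n : 0# < (1# + n)
    0<1+n = <-≤-trans 0<1 (≤-+ʳ (proj₁ 0<n))
    ⁻¹-*-cancel′ : a * (a * n) ≈ a
    ⁻¹-*-cancel′ = trans (*-congˡ (⁻¹-inverseˡ⁺ 0<n)) (*-identityʳ a)
    nn·aa≈1 : n * n * (a * a) ≈ 1#
    nn·aa≈1 = trans (solve 2 (λ n a → n :* n :* (a :* a) := (n :* a) :* (n :* a)) refl n a)
                    (trans (*-cong (⁻¹-inverseʳ⁺ 0<n) (⁻¹-inverseʳ⁺ 0<n)) (*-identityˡ 1#))

  module Optimum {n′ : ℕ} (g : Fin N → Fin (suc (suc n′))) (onto : IsPartition (suc (suc n′)) g) where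
    A : Fin (suc (suc n′)) → Subset
    A = block g

    p r : Fin (suc (suc n′)) → Carrier
    p i = mass (A i)
    r i = ratio (A i)

    0<p : ∀ i → 0# < p i
    0<p i = block-pos g i (onto i)

    open Identity r p (λ i j → flow (A i) (A j)) (blocks-mass g)
      (λ i → trans (boundary-as-flows g i) (sym (ratio*mass (A i) (0<p i))))

    n : Carrier
    n = fromℕ (suc n′)

    0<n : 0# < n
    0<n = fromℕ-pos n′

    merged-ratio : ∀ {i j} → i ≢ j → 0# ≤ T i j → ratio (A i ∪ A j) ≤ (r i + r j) - S * n ⁻¹
    merged-ratio {i} {j} i≢j 0≤T = ≤-resp (sym ratio≈) refl (+-monoʳ-≤ (r i + r j) (neg-antitone S/n≤X/q))
      where
      q : Carrier
      q = p i + p j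
      0<q : 0# < q
      0<q = <-≤-trans (0<p i) (≤-+ʳ (proj₁ (0<p j)))
      S/n≤X/q : S * n ⁻¹ ≤ X i j * q ⁻¹
      S/n≤X/q = cross-≤ 0<n 0<q (≤-resp refl (*-comm _ _) (0≤-⇒≤ 0≤T))
      ratio≈ : ratio (A i ∪ A j) ≈ (r i + r j) - X i j * q ⁻¹
      ratio≈ = begin
        boundary (A i ∪ A j) * mass (A i ∪ A j) ⁻¹
          ≈⟨ *-cong (boundary-∪ (A i) (A j) (blocks-disjoint g i≢j))
                    (⁻¹-cong (<-respʳ 0<q (sym (mass-∪ (A i) (A j) (blocks-disjoint g i≢j))))
                             (mass-∪ (A i) (A j) (blocks-disjoint g i≢j))) ⟩
        (((boundary (A i) + boundary (A j)) - flow (A i) (A j)) - flow (A j) (A i)) * q ⁻¹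
          ≈⟨ *-congʳ (+-congʳ (+-congʳ (+-cong (sym (ratio*mass (A i) (0<p i)))
                                               (sym (ratio*mass (A j) (0<p j)))))) ⟩
        (((r i * p i + r j * p j) - flow (A i) (A j)) - flow (A j) (A i)) * q ⁻¹
          ≈⟨ *-congʳ (solve 6 (λ ri rj pi pj cij cji → ((ri :* pi :+ rj :* pj) :- cij) :- cji
                                   := (ri :+ rj) :* (pi :+ pj) :- (ri :* pj :+ rj :* pi :+ cij :+ cji))
                              refl (r i) (r j) (p i) (p j) (flow (A i) (A j)) (flow (A j) (A i))) ⟩
        ((r i + r j) * q - X i j) * q ⁻¹
          ≈⟨ solve 4 (λ a b c d → (a :* b :- c) :* d := a :* b :* d :- c :* d)
                     refl (r i + r j) q (X i j) (q ⁻¹) ⟩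
        (r i + r j) * q * q ⁻¹ - X i j * q ⁻¹
          ≈⟨ +-congʳ (*-⁻¹-cancel (r i + r j) 0<q) ⟩
        (r i + r j) - X i j * q ⁻¹ ∎

    merged-value : ∀ {i j} (i≢j : i ≢ j) → 0# ≤ T i j →
      ι~ G (suc n′) ≤ (1# - (n * n) ⁻¹) * value G (suc (suc n′)) (asFamily g)
    merged-value {i} {j} i≢j 0≤T = ≤-trans (ι~-≤ (suc n′) h onto′)
      (≤-resp refl (shrink-identity n S 0<n) (*-monoˡ-≤ (n ⁻¹) (⁻¹-nonneg 0<n) sum-bound))
      where
      open MergeLabels i≢j
      h : Fin N → Fin (suc n′)
      h u = mergeLabel (g u)
      onto′ : IsPartition (suc n′) h
      onto′ k with onto (punchIn j k)
      ... | u , gu≡ = u , mergeLabel-hit k (g u) gu≡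
      Rest : Carrier
      Rest = sumF (λ l → r (punchIn j (punchIn k₀ l)))
      new-sum : sumF (λ k → ratio (block h k)) ≈ ratio (A i ∪ A j) + Rest
      new-sum = trans (sumF-extract k₀ (λ k → ratio (block h k)))
        (+-cong (ratio-cong (block-pos h k₀ (onto′ k₀)) (λ u → mergeLabel-merged (g u)))
                (sumF-cong (λ l → ratio-cong (block-pos h (punchIn k₀ l) (onto′ (punchIn k₀ l)))
                                             (λ u → mergeLabel-kept (g u) l))))
      old-sum : S ≈ r j + (r i + Rest)
      old-sum = trans (sumF-extract j r) (+-congˡ (trans (sumF-extract k₀ (λ k → r (punchIn j k)))
                  (+-congʳ (reflexive (P.cong r (FinP.punchIn-punchOut j≢i))))))
      sum-bound : sumF (λ k → ratio (block h k)) ≤ S - S * n ⁻¹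
      sum-bound = ≤-resp (sym new-sum)
        (trans (solve 4 (λ ri rj s rest → ((ri :+ rj) :- s) :+ rest := (rj :+ (ri :+ rest)) :- s)
                        refl (r i) (r j) (S * n ⁻¹) Rest)
               (+-congʳ (sym old-sum)))
        (+-monoˡ-≤ Rest (merged-ratio i≢j 0≤T))

    good-pair : ∃₂ λ i j → i ≢ j × 0# ≤ T i j
    good-pair = offSum-nonneg-entry T ΣT≈0

    bound : ι~ G (suc n′) ≤ (1# - (n * n) ⁻¹) * value G (suc (suc n′)) (asFamily g)
    bound = let (_ , _ , i≢j , 0≤T) = good-pair in merged-value i≢j 0≤T

  partC : ∀ n → 1 ℕ.≤ n → suc n ℕ.≤ N → ι~ G n ≤ (1# - (fromℕ n * fromℕ n) ⁻¹) * ι~ G (suc n)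
  partC (suc n′) _ n+1≤N with optimal-partition (suc (suc n′)) (s≤s z≤n) n+1≤N
  ... | g , onto , ι~≡ = ≤-resp refl (*-congˡ (reflexive (P.sym ι~≡))) (Optimum.bound g onto)

-- The statement uses the order of ℕ, which would clash with the field order
-- inside the modules above.
open import Data.Nat using (_≤_)

corollary1 : (F : OrderedField) (N : ℕ) (G : MarkovGraph F N) →
  let open OrderedField F renaming (_≤_ to _≤F_) in
  ((n : ℕ) → 1 ≤ n → n ≤ N →
      (0# ≤F (ι~ G n - ι G n)) × ((ι~ G n - ι G n) ≤F (fromℕ n ⁻¹)))
  × (2 ≤ N → ι~ G 2 ≈ ι G 2)
  × ((n : ℕ) → 1 ≤ n → suc n ≤ N →
      ι~ G n ≤F ((1# - (fromℕ n * fromℕ n) ⁻¹) * ι~ G (suc n)))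
  × ((n : ℕ) → 1 ≤ n → suc n ≤ N → ι G n ≤F ι G (suc n))
corollary1 F N G = PartA.partA G , PartB.partB G , PartC.partC G , PartD.ι-mono G
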